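{- Let $\chi_5(d)=\left(\frac{d}{5}\right)$ be the Legendre symbol modulo $5$ (the quadratic character mod 5), let $p(n)$ be the partition function, and define \[ \sigma^{\chi_5}_3(n)=\sum_{d\mid n}\chi_5(d)\,d^3,\qquad \widehat M^{\chi_5}_3(n)=\sum_{t=1}^{n}\sigma^{\chi_5}_3(t)\,p(n-t). \] Then $\widehat M^{\chi_5}_3(5n+4)\equiv0\pmod5$ for all $n\ge0$. -}

module Defs where

open import Data.Nat as ℕ using (ℕ; zero; suc; _∸_; _%_)
open import Data.Integer as ℤ using (ℤ; +_; -[1+_]; _+_; _*_; 0ℤ; _^_)
open import Data.Bool using (Bool; true; false; if_then_else_)
open import Data.Nat.Divisibility using (_∣?_)
open import Relation.Nullary.Decidable using (does)

-- Number of partitions of n into parts each of size at most k.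
-- parts≤ n k : parts of size ≤ k.
-- A partition with parts ≤ (k+1) either uses no part k+1 (parts≤ n k)
-- or uses at least one part k+1 (parts≤ (n - (k+1)) (k+1)).
-- We recurse with explicit fuel f ≥ n to stay structural.
partsFuel : ℕ → ℕ → ℕ → ℕ
partsFuel _        zero    zero    = 1
partsFuel _        (suc _) zero    = 0
partsFuel zero     _       (suc _) = 1  -- only reached with n = 0 (fuel ≥ n)
partsFuel (suc f)  n       (suc k) =
  partsFuel (suc f) n k ℕ.+ useBig
  where
  useBig : ℕ
  useBig with n ℕ.<ᵇ suc k
  ... | true  = 0
  ... | false = partsFuel f (n ∸ suc k) (suc k)

p : ℕ → ℕ
p n = partsFuel n n n

χ₅ : ℕ → ℤ
χ₅ d with d % 5
... | 1 = + 1
... | 4 = + 1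
... | 2 = -[1+ 0 ]
... | 3 = -[1+ 0 ]
... | _ = 0ℤ

sumFrom1 : ℕ → (ℕ → ℤ) → ℤ
sumFrom1 zero    f = 0ℤ
sumFrom1 (suc m) f = sumFrom1 m f + f (suc m)

σχ₅₃ : ℕ → ℤ
σχ₅₃ n = sumFrom1 n (λ d → if does (d ∣? n) then χ₅ d * (+ d) ^ 3 else 0ℤ)

Mχ₅₃ : ℕ → ℤ
Mχ₅₃ n = sumFrom1 n (λ t → σχ₅₃ t * + p (n ∸ t))

-- Since χ₅(d) ≡ d² (mod 5), we have χ₅(d) d³ ≡ d⁵ ≡ d, so σ^{χ₅}_3(t) ≡ σ(t) (mod 5), and
-- Euler's identity Σ_{t ≤ n} σ(t) p(n - t) = n p(n), read off from the logarithmic derivative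
-- of P = Π_a (1 - q^a)⁻¹, gives M̂(n) ≡ n p(n) (mod 5).  What remains is Ramanujan's
-- congruence p(5m + 4) ≡ 0 (mod 5).
--
-- For it, let E = Π_a (1 - q^a).  Then E⁵ ≡ E(q⁵) (mod 5), so P E(q⁵)² ≡ E⁹ = (E³)³ (mod 5).
-- By Jacobi's identity E³ = Σ_k (-1)^k (2k + 1) q^{k(k+1)/2}, and k(k+1)/2 ≡ 3 (mod 5) only if
-- 5 ∣ 2k + 1; hence E³ is congruent mod 5 to a series whose exponents are ≡ 0 or 1 (mod 5),
-- and its cube has no exponents ≡ 4.  Since E(q⁵)² is a series in q⁵ with constant term 1,
-- the coefficients p(5m + 4) vanish mod 5 by induction on m.
--
-- Jacobi's identity is proved modulo q^n from a finite form.  With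
-- c(n, j) = (-1)^{n+j} q^{T(j - n)} [2n choose j]_q, the Pascal rules for Gaussian polynomials
-- give c(n + 1, j + 1) = (1 + q^{2n+1}) c(n, j) - q^{n+1} c(n, j - 1) - q^n c(n, j + 1), whence
-- Σ_j c(n, j) = 0 and Σ_j (j - n) c(n, j) = (q;q)_n (q;q)_{n-1} for n ≥ 1; and
-- [2n choose j]_q (q;q)_M ≡ 1 modulo a power of q large enough that
-- c(n, j) (q;q)_M ≡ (-1)^{n+j} q^{T(j - n)} (mod q^n).

module Submission where

open import Defs
open import Data.Nat using (ℕ; _+_; _*_)
open import Data.Integer using (+_)
open import Data.Integer.Divisibility using (_∣_)

open import Algebra.Bundles using (CommutativeRing)
import Algebra.Solver.Ring
import Algebra.Solver.Ring.AlmostCommutativeRing as ACR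
open import Data.Bool as Bool using (true; false; if_then_else_)
open import Data.Empty using (⊥-elim)
open import Data.Integer as ℤ using (ℤ; 0ℤ; 1ℤ; -[1+_])
import Data.Integer.Divisibility.Signed as ℤ
import Data.Integer.Properties as ℤ
open import Data.Integer.Tactic.RingSolver using (solve-∀)
open import Data.Maybe using (Maybe; just; nothing)
open import Data.Nat as ℕ using (zero; suc; _∸_; _%_; _/_; _≤_; _<_; z≤n; s≤s)
open import Data.Nat.Divisibility as ℕ using (_∣?_)
import Data.Nat.DivMod as ℕ
open import Data.Nat.Induction using (<-rec)
import Data.Nat.Properties as ℕ
import Data.Nat.Tactic.RingSolver as ℕ
open import Data.Product using (Σ-syntax; _×_; _,_; proj₁; proj₂)
open import Data.Sum using (_⊎_; inj₁; inj₂)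
open import Data.Unit using (tt)
open import Function using (_∘_)
open import Level using (0ℓ)
open import Relation.Binary.Bundles using (Setoid)
open import Relation.Binary.PropositionalEquality
  using (_≡_; _≢_; refl; sym; trans; cong; cong₂; subst; module ≡-Reasoning)
import Relation.Binary.Reasoning.Setoid as SetoidReasoning
open import Relation.Binary.Structures using (IsEquivalence)
open import Relation.Nullary using (yes; no; does)

-- Formal power series over ℤ

Series : Set
Series = ℕ → ℤ

infix 4 _≋_
record _≋_ (f g : Series) : Set where
  constructor mk≋
  field coeff : ∀ n → f n ≡ g n
open _≋_ public

infixl 6 _⊕_
infixl 7 _⊛_ _∙_
infix 8 ⊝_

const : ℤ → Series
const c zero    = c
const c (suc _) = 0ℤ

𝟘 𝟙 : Series
𝟘 _ = 0ℤ
𝟙 = const 1ℤ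

_⊕_ : Series → Series → Series
(f ⊕ g) n = f n ℤ.+ g n

⊝_ : Series → Series
(⊝ f) n = ℤ.- f n

_∙_ : ℤ → Series → Series
(c ∙ f) n = c ℤ.* f n

tail : Series → Series
tail f n = f (suc n)

_⊛_ : Series → Series → Series
(f ⊛ g) zero    = f 0 ℤ.* g 0
(f ⊛ g) (suc n) = f 0 ℤ.* g (suc n) ℤ.+ (tail f ⊛ g) n

coeff-⊛-closed : (P : ℤ → Set) → (∀ {a b} → P a → P b → P (a ℤ.+ b)) →
                 ∀ f g n → (∀ i j → i + j ≡ n → P (f i ℤ.* g j)) → P ((f ⊛ g) n)
coeff-⊛-closed P +-closed f g zero    terms = terms 0 0 refl
coeff-⊛-closed P +-closed f g (suc n) terms =
  +-closed (terms 0 (suc n) refl)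
           (coeff-⊛-closed P +-closed (tail f) g n (λ i j i+j≡n → terms (suc i) j (cong suc i+j≡n)))

≋-refl : ∀ {f} → f ≋ f
≋-refl = mk≋ (λ _ → refl)

≋-sym : ∀ {f g} → f ≋ g → g ≋ f
≋-sym f≋g = mk≋ (λ n → sym (coeff f≋g n))

≋-trans : ∀ {f g h} → f ≋ g → g ≋ h → f ≋ h
≋-trans f≋g g≋h = mk≋ (λ n → trans (coeff f≋g n) (coeff g≋h n))

≋-reflexive : ∀ {f g} → f ≡ g → f ≋ g
≋-reflexive refl = ≋-refl

⊕-cong : ∀ {f f′ g g′} → f ≋ f′ → g ≋ g′ → f ⊕ g ≋ f′ ⊕ g′
⊕-cong f≋f′ g≋g′ = mk≋ (λ n → cong₂ ℤ._+_ (coeff f≋f′ n) (coeff g≋g′ n))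

⊝-cong : ∀ {f f′} → f ≋ f′ → ⊝ f ≋ ⊝ f′
⊝-cong f≋f′ = mk≋ (λ n → cong ℤ.-_ (coeff f≋f′ n))

∙-congˡ : ∀ c {f f′} → f ≋ f′ → c ∙ f ≋ c ∙ f′
∙-congˡ c f≋f′ = mk≋ (λ n → cong (c ℤ.*_) (coeff f≋f′ n))

⊛-cong : ∀ {f f′ g g′} → f ≋ f′ → g ≋ g′ → f ⊛ g ≋ f′ ⊛ g′
⊛-cong f≋f′ g≋g′ = mk≋ (go f≋f′)
  where
  go : ∀ {f f′} → f ≋ f′ → ∀ n → (f ⊛ _) n ≡ (f′ ⊛ _) n
  go f≋f′ zero    = cong₂ ℤ._*_ (coeff f≋f′ 0) (coeff g≋g′ 0)
  go f≋f′ (suc n) = cong₂ ℤ._+_ (cong₂ ℤ._*_ (coeff f≋f′ 0) (coeff g≋g′ (suc n))) (go (mk≋ (coeff f≋f′ ∘ suc)) n)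

⊛-congˡ : ∀ {f g g′} → g ≋ g′ → f ⊛ g ≋ f ⊛ g′
⊛-congˡ = ⊛-cong ≋-refl

⊛-congʳ : ∀ {f f′ g} → f ≋ f′ → f ⊛ g ≋ f′ ⊛ g
⊛-congʳ f≋f′ = ⊛-cong f≋f′ ≋-refl

⊛-zeroˡ : ∀ f → 𝟘 ⊛ f ≋ 𝟘
⊛-zeroˡ f = mk≋ go
  where
  go : ∀ n → (𝟘 ⊛ f) n ≡ 0ℤ
  go zero    = refl
  go (suc n) = trans (ℤ.+-identityˡ _) (go n)

⊕-identityʳ : ∀ f → f ⊕ 𝟘 ≋ f
⊕-identityʳ f = mk≋ (λ n → ℤ.+-identityʳ (f n))

⊕-identityˡ : ∀ f → 𝟘 ⊕ f ≋ f
⊕-identityˡ f = mk≋ (λ n → ℤ.+-identityˡ (f n))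

⊝-⊛ : ∀ f g → ⊝ f ⊛ g ≋ ⊝ (f ⊛ g)
⊝-⊛ f g = mk≋ (go f)
  where
  go : ∀ f n → (⊝ f ⊛ g) n ≡ ℤ.- (f ⊛ g) n
  go f zero    = sym (ℤ.neg-distribˡ-* (f 0) (g 0))
  go f (suc n) = trans (cong₂ ℤ._+_ (sym (ℤ.neg-distribˡ-* (f 0) (g (suc n)))) (go (tail f) n))
                       (sym (ℤ.neg-distrib-+ (f 0 ℤ.* g (suc n)) ((tail f ⊛ g) n)))

const-⊛ : ∀ c f → const c ⊛ f ≋ c ∙ f
const-⊛ c f = mk≋ λ
  { zero    → refl
  ; (suc n) → trans (cong (ℤ._+_ (c ℤ.* f (suc n))) (coeff (⊛-zeroˡ f) n)) (ℤ.+-identityʳ _) }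

⊛-identityˡ : ∀ f → 𝟙 ⊛ f ≋ f
⊛-identityˡ f = ≋-trans (const-⊛ 1ℤ f) (mk≋ (λ n → ℤ.*-identityˡ (f n)))

⊛-distribʳ : ∀ h f g → (f ⊕ g) ⊛ h ≋ f ⊛ h ⊕ g ⊛ h
⊛-distribʳ h f g = mk≋ (go f g)
  where
  go : ∀ f g n → ((f ⊕ g) ⊛ h) n ≡ (f ⊛ h ⊕ g ⊛ h) n
  go f g zero    = ℤ.*-distribʳ-+ (h 0) (f 0) (g 0)
  go f g (suc n) = begin
    (f 0 ℤ.+ g 0) ℤ.* h (suc n) ℤ.+ ((tail f ⊕ tail g) ⊛ h) n
      ≡⟨ cong₂ ℤ._+_ (ℤ.*-distribʳ-+ (h (suc n)) (f 0) (g 0)) (go (tail f) (tail g) n) ⟩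
    (f 0 ℤ.* h (suc n) ℤ.+ g 0 ℤ.* h (suc n)) ℤ.+ ((tail f ⊛ h) n ℤ.+ (tail g ⊛ h) n)
      ≡⟨ interchange (f 0 ℤ.* h (suc n)) (g 0 ℤ.* h (suc n)) ((tail f ⊛ h) n) ((tail g ⊛ h) n) ⟩
    (f ⊛ h ⊕ g ⊛ h) (suc n) ∎
    where
    open ≡-Reasoning
    interchange : ∀ a b c d → (a ℤ.+ b) ℤ.+ (c ℤ.+ d) ≡ (a ℤ.+ c) ℤ.+ (b ℤ.+ d)
    interchange = solve-∀

∙-⊛ : ∀ c f g → c ∙ f ⊛ g ≋ c ∙ (f ⊛ g)
∙-⊛ c f g = mk≋ (go f)
  where
  go : ∀ f n → (c ∙ f ⊛ g) n ≡ (c ∙ (f ⊛ g)) n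
  go f zero    = ℤ.*-assoc c (f 0) (g 0)
  go f (suc n) = trans (cong₂ ℤ._+_ (ℤ.*-assoc c (f 0) (g (suc n))) (go (tail f) n))
                       (sym (ℤ.*-distribˡ-+ c (f 0 ℤ.* g (suc n)) ((tail f ⊛ g) n)))

⊛-sucʳ : ∀ f g n → (f ⊛ g) (suc n) ≡ (f ⊛ tail g) n ℤ.+ f (suc n) ℤ.* g 0
⊛-sucʳ f g zero    = refl
⊛-sucʳ f g (suc n) =
  trans (cong (ℤ._+_ (f 0 ℤ.* g (2 + n))) (⊛-sucʳ (tail f) g n))
        (sym (ℤ.+-assoc (f 0 ℤ.* g (2 + n)) ((tail f ⊛ tail g) n) (f (2 + n) ℤ.* g 0)))

⊛-comm : ∀ f g → f ⊛ g ≋ g ⊛ f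
⊛-comm f g = mk≋ (go f g)
  where
  go : ∀ f g n → (f ⊛ g) n ≡ (g ⊛ f) n
  go f g zero    = ℤ.*-comm (f 0) (g 0)
  go f g (suc n) = begin
    (f ⊛ g) (suc n)                          ≡⟨ ⊛-sucʳ f g n ⟩
    (f ⊛ tail g) n ℤ.+ f (suc n) ℤ.* g 0     ≡⟨ cong₂ ℤ._+_ (go f (tail g) n) (ℤ.*-comm (f (suc n)) (g 0)) ⟩
    (tail g ⊛ f) n ℤ.+ g 0 ℤ.* f (suc n)     ≡⟨ ℤ.+-comm ((tail g ⊛ f) n) (g 0 ℤ.* f (suc n)) ⟩
    (g ⊛ f) (suc n)                          ∎
    where open ≡-Reasoning

⊛-identityʳ : ∀ f → f ⊛ 𝟙 ≋ f
⊛-identityʳ f = ≋-trans (⊛-comm f 𝟙) (⊛-identityˡ f)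

⊛-distribˡ : ∀ f g h → f ⊛ (g ⊕ h) ≋ f ⊛ g ⊕ f ⊛ h
⊛-distribˡ f g h = ≋-trans (⊛-comm f (g ⊕ h)) (≋-trans (⊛-distribʳ f g h) (⊕-cong (⊛-comm g f) (⊛-comm h f)))

⊛-zeroʳ : ∀ f → f ⊛ 𝟘 ≋ 𝟘
⊛-zeroʳ f = ≋-trans (⊛-comm f 𝟘) (⊛-zeroˡ f)

⊛-assoc : ∀ f g h → (f ⊛ g) ⊛ h ≋ f ⊛ (g ⊛ h)
⊛-assoc f g h = mk≋ (go f)
  where
  go : ∀ f n → ((f ⊛ g) ⊛ h) n ≡ (f ⊛ (g ⊛ h)) n
  go f zero    = ℤ.*-assoc (f 0) (g 0) (h 0)
  go f (suc n) = begin
    (f 0 ℤ.* g 0) ℤ.* h (suc n) ℤ.+ ((f 0 ∙ tail g ⊕ tail f ⊛ g) ⊛ h) n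
      ≡⟨ cong (ℤ._+_ (f 0 ℤ.* g 0 ℤ.* h (suc n))) (coeff (⊛-distribʳ h (f 0 ∙ tail g) (tail f ⊛ g)) n) ⟩
    (f 0 ℤ.* g 0) ℤ.* h (suc n) ℤ.+ ((f 0 ∙ tail g ⊛ h) n ℤ.+ ((tail f ⊛ g) ⊛ h) n)
      ≡⟨ cong (ℤ._+_ (f 0 ℤ.* g 0 ℤ.* h (suc n))) (cong₂ ℤ._+_ (coeff (∙-⊛ (f 0) (tail g) h) n) (go (tail f) n)) ⟩
    (f 0 ℤ.* g 0) ℤ.* h (suc n) ℤ.+ (f 0 ℤ.* (tail g ⊛ h) n ℤ.+ (tail f ⊛ (g ⊛ h)) n)
      ≡⟨ regroup (f 0) (g 0) (h (suc n)) ((tail g ⊛ h) n) ((tail f ⊛ (g ⊛ h)) n) ⟩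
    (f ⊛ (g ⊛ h)) (suc n) ∎
    where
    open ≡-Reasoning
    regroup : ∀ a b c d e → a ℤ.* b ℤ.* c ℤ.+ (a ℤ.* d ℤ.+ e) ≡ a ℤ.* (b ℤ.* c ℤ.+ d) ℤ.+ e
    regroup = solve-∀

≋-isEquivalence : IsEquivalence _≋_
≋-isEquivalence = record { refl = ≋-refl ; sym = ≋-sym ; trans = ≋-trans }

commutativeRing : CommutativeRing 0ℓ 0ℓ
commutativeRing = record
  { Carrier = Series ; _≈_ = _≋_ ; _+_ = _⊕_ ; _*_ = _⊛_ ; -_ = ⊝_ ; 0# = 𝟘 ; 1# = 𝟙
  ; isCommutativeRing = record
    { isRing = record
      { +-isAbelianGroup = record
        { isGroup = record
          { isMonoid = record
            { isSemigroup = record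
              { isMagma = record { isEquivalence = ≋-isEquivalence ; ∙-cong = ⊕-cong }
              ; assoc = λ f g h → mk≋ (λ n → ℤ.+-assoc (f n) (g n) (h n)) }
            ; identity = (λ f → mk≋ (ℤ.+-identityˡ ∘ f)) , (λ f → mk≋ (ℤ.+-identityʳ ∘ f)) }
          ; inverse = (λ f → mk≋ (ℤ.+-inverseˡ ∘ f)) , (λ f → mk≋ (ℤ.+-inverseʳ ∘ f))
          ; ⁻¹-cong = ⊝-cong }
        ; comm = λ f g → mk≋ (λ n → ℤ.+-comm (f n) (g n)) }
      ; *-cong = ⊛-cong
      ; *-assoc = ⊛-assoc
      ; *-identity = ⊛-identityˡ , ⊛-identityʳ
      ; distrib = ⊛-distribˡ , ⊛-distribʳ }
    ; *-comm = ⊛-comm } }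

≋-setoid : Setoid 0ℓ 0ℓ
≋-setoid = CommutativeRing.setoid commutativeRing

module ≋-Reasoning = SetoidReasoning ≋-setoid

const-homomorphism : ACR._-Raw-AlmostCommutative⟶_ (CommutativeRing.rawRing ℤ.+-*-commutativeRing)
                                                    (ACR.fromCommutativeRing commutativeRing)
const-homomorphism = record
  { ⟦_⟧    = const
  ; +-homo = λ a b → mk≋ λ { zero → refl ; (suc n) → refl }
  ; *-homo = λ a b → ≋-sym (≋-trans (const-⊛ a (const b)) (mk≋ λ { zero → refl ; (suc n) → ℤ.*-zeroʳ a }))
  ; -‿homo = λ a → mk≋ λ { zero → refl ; (suc n) → refl }
  ; 0-homo = mk≋ λ { zero → refl ; (suc n) → refl }
  ; 1-homo = ≋-refl
  }

const-≟ : ∀ a b → Maybe (const a ≋ const b)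
const-≟ a b with a ℤ.≟ b
... | yes refl = just ≋-refl
... | no _     = nothing

open Algebra.Solver.Ring _ _ const-homomorphism const-≟ public using (solve; _:=_; _:+_; _:*_; :-_; _:-_; con)

-- Monomials and congruence modulo X^K

infix 9 X^_

X^_ : ℕ → Series
X^ zero = 𝟙
(X^ suc a) zero    = 0ℤ
(X^ suc a) (suc n) = (X^ a) n

X^-coeff-≢ : ∀ k {i} → i ≢ k → (X^ k) i ≡ 0ℤ
X^-coeff-≢ zero    {zero}  i≢k = ⊥-elim (i≢k refl)
X^-coeff-≢ zero    {suc i} i≢k = refl
X^-coeff-≢ (suc k) {zero}  i≢k = refl
X^-coeff-≢ (suc k) {suc i} i≢k = X^-coeff-≢ k (i≢k ∘ cong suc)

X^suc-⊛-suc : ∀ a f n → (X^ suc a ⊛ f) (suc n) ≡ (X^ a ⊛ f) n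
X^suc-⊛-suc a f n = ℤ.+-identityˡ _

X^-⊛-below : ∀ a f {n} → n < a → (X^ a ⊛ f) n ≡ 0ℤ
X^-⊛-below (suc a) f {zero}  _         = refl
X^-⊛-below (suc a) f {suc n} (s≤s n<a) = trans (X^suc-⊛-suc a f n) (X^-⊛-below a f n<a)

X^-⊛-shift : ∀ a f r → (X^ a ⊛ f) (a + r) ≡ f r
X^-⊛-shift zero    f r = coeff (⊛-identityˡ f) r
X^-⊛-shift (suc a) f r = trans (X^suc-⊛-suc a f (a + r)) (X^-⊛-shift a f r)

X^-+ : ∀ a b → X^ a ⊛ X^ b ≋ X^ (a + b)
X^-+ zero    b = ⊛-identityˡ (X^ b)
X^-+ (suc a) b = mk≋ λ
  { zero    → refl
  ; (suc n) → trans (X^suc-⊛-suc a (X^ b) n) (coeff (X^-+ a b) n) }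

infix 4 _≋_modX^_

_≋_modX^_ : Series → Series → ℕ → Set
f ≋ g modX^ K = ∀ i → i < K → f i ≡ g i

module _ {K : ℕ} where

  ≋⇒≋modX^ : ∀ {f g} → f ≋ g → f ≋ g modX^ K
  ≋⇒≋modX^ f≋g i _ = coeff f≋g i

  modX^-refl : ∀ {f} → f ≋ f modX^ K
  modX^-refl _ _ = refl

  modX^-sym : ∀ {f g} → f ≋ g modX^ K → g ≋ f modX^ K
  modX^-sym f≈g i i<K = sym (f≈g i i<K)

  modX^-trans : ∀ {f g h} → f ≋ g modX^ K → g ≋ h modX^ K → f ≋ h modX^ K
  modX^-trans f≈g g≈h i i<K = trans (f≈g i i<K) (g≈h i i<K)

  modX^-respects-≋ : ∀ {f f′ g g′} → f ≋ f′ → g ≋ g′ → f ≋ g modX^ K → f′ ≋ g′ modX^ K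
  modX^-respects-≋ f≋f′ g≋g′ f≈g i i<K = trans (sym (coeff f≋f′ i)) (trans (f≈g i i<K) (coeff g≋g′ i))

  modX^-⊕ : ∀ {f f′ g g′} → f ≋ f′ modX^ K → g ≋ g′ modX^ K → f ⊕ g ≋ f′ ⊕ g′ modX^ K
  modX^-⊕ f≈f′ g≈g′ i i<K = cong₂ ℤ._+_ (f≈f′ i i<K) (g≈g′ i i<K)

  modX^-∙ : ∀ c {f f′} → f ≋ f′ modX^ K → c ∙ f ≋ c ∙ f′ modX^ K
  modX^-∙ c f≈f′ i i<K = cong (c ℤ.*_) (f≈f′ i i<K)

  modX^-⊛ : ∀ {f f′ g g′} → f ≋ f′ modX^ K → g ≋ g′ modX^ K → f ⊛ g ≋ f′ ⊛ g′ modX^ K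
  modX^-⊛ f≈f′ g≈g′ i i<K =
    go i (λ j j≤i → f≈f′ j (ℕ.≤-<-trans j≤i i<K)) (λ j j≤i → g≈g′ j (ℕ.≤-<-trans j≤i i<K))
    where
    go : ∀ i {f f′ g g′} → (∀ j → j ≤ i → f j ≡ f′ j) → (∀ j → j ≤ i → g j ≡ g′ j) →
         (f ⊛ g) i ≡ (f′ ⊛ g′) i
    go zero    f≈f′ g≈g′ = cong₂ ℤ._*_ (f≈f′ 0 z≤n) (g≈g′ 0 z≤n)
    go (suc i) f≈f′ g≈g′ = cong₂ ℤ._+_ (cong₂ ℤ._*_ (f≈f′ 0 z≤n) (g≈g′ (suc i) ℕ.≤-refl))
                                      (go i (λ j j≤i → f≈f′ (suc j) (s≤s j≤i))
                                            (λ j j≤i → g≈g′ j (ℕ.m≤n⇒m≤1+n j≤i)))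

modX^-mono : ∀ {K K′ f g} → K′ ≤ K → f ≋ g modX^ K → f ≋ g modX^ K′
modX^-mono K′≤K f≈g i i<K′ = f≈g i (ℕ.<-≤-trans i<K′ K′≤K)

modX^-X^-⊛ : ∀ a {K f g} → f ≋ g modX^ K → X^ a ⊛ f ≋ X^ a ⊛ g modX^ (a + K)
modX^-X^-⊛ zero    f≈g = modX^-respects-≋ (≋-sym (⊛-identityˡ _)) (≋-sym (⊛-identityˡ _)) f≈g
modX^-X^-⊛ (suc a) f≈g zero    _           = refl
modX^-X^-⊛ (suc a) {f = f} {g} f≈g (suc i) (s≤s i<a+K) =
  trans (X^suc-⊛-suc a f i) (trans (modX^-X^-⊛ a f≈g i i<a+K) (sym (X^suc-⊛-suc a g i)))

-- Congruence modulo an integer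

module Congruence (m : ℤ) where

  infix 4 _≡ₘ_ _≋ₘ_

  record _≡ₘ_ (a b : ℤ) : Set where
    constructor ≡ₘ-intro
    field divides-difference : m ℤ.∣ a ℤ.- b

  ≡ₘ-reflexive : ∀ {a b} → a ≡ b → a ≡ₘ b
  ≡ₘ-reflexive {a} refl = ≡ₘ-intro (subst (m ℤ.∣_) (sym (ℤ.+-inverseʳ a)) (ℤ.divides 0ℤ refl))

  ≡ₘ-refl : ∀ {a} → a ≡ₘ a
  ≡ₘ-refl = ≡ₘ-reflexive refl

  ≡ₘ-sym : ∀ {a b} → a ≡ₘ b → b ≡ₘ a
  ≡ₘ-sym {a} {b} (≡ₘ-intro m∣a-b) = ≡ₘ-intro (subst (m ℤ.∣_) (negate-difference a b) (ℤ.∣m⇒∣-m m∣a-b))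
    where
    negate-difference : ∀ a b → ℤ.- (a ℤ.- b) ≡ b ℤ.- a
    negate-difference = solve-∀

  ≡ₘ-trans : ∀ {a b c} → a ≡ₘ b → b ≡ₘ c → a ≡ₘ c
  ≡ₘ-trans {a} {b} {c} (≡ₘ-intro m∣a-b) (≡ₘ-intro m∣b-c) =
    ≡ₘ-intro (subst (m ℤ.∣_) (telescope a b c) (ℤ.∣m∣n⇒∣m+n m∣a-b m∣b-c))
    where
    telescope : ∀ a b c → (a ℤ.- b) ℤ.+ (b ℤ.- c) ≡ a ℤ.- c
    telescope = solve-∀

  +-cong : ∀ {a a′ b b′} → a ≡ₘ a′ → b ≡ₘ b′ → a ℤ.+ b ≡ₘ a′ ℤ.+ b′
  +-cong {a} {a′} {b} {b′} (≡ₘ-intro m∣a-a′) (≡ₘ-intro m∣b-b′) =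
    ≡ₘ-intro (subst (m ℤ.∣_) (regroup a a′ b b′) (ℤ.∣m∣n⇒∣m+n m∣a-a′ m∣b-b′))
    where
    regroup : ∀ a a′ b b′ → (a ℤ.- a′) ℤ.+ (b ℤ.- b′) ≡ (a ℤ.+ b) ℤ.- (a′ ℤ.+ b′)
    regroup = solve-∀

  *-cong : ∀ {a a′ b b′} → a ≡ₘ a′ → b ≡ₘ b′ → a ℤ.* b ≡ₘ a′ ℤ.* b′
  *-cong {a} {a′} {b} {b′} (≡ₘ-intro m∣a-a′) (≡ₘ-intro m∣b-b′) =
    ≡ₘ-intro (subst (m ℤ.∣_) (regroup a a′ b b′) (ℤ.∣m∣n⇒∣m+n (ℤ.∣m⇒∣m*n b m∣a-a′) (ℤ.∣n⇒∣m*n a′ m∣b-b′)))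
    where
    regroup : ∀ a a′ b b′ → (a ℤ.- a′) ℤ.* b ℤ.+ a′ ℤ.* (b ℤ.- b′) ≡ a ℤ.* b ℤ.- a′ ℤ.* b′
    regroup = solve-∀

  -‿cong : ∀ {a b} → a ≡ₘ b → ℤ.- a ≡ₘ ℤ.- b
  -‿cong {a} {b} (≡ₘ-intro m∣a-b) = ≡ₘ-intro (subst (m ℤ.∣_) (negate a b) (ℤ.∣m⇒∣-m m∣a-b))
    where
    negate : ∀ a b → ℤ.- (a ℤ.- b) ≡ ℤ.- a ℤ.- ℤ.- b
    negate = solve-∀

  +-cancelʳ-≡ₘ0 : ∀ {a b} → a ℤ.+ b ≡ₘ 0ℤ → b ≡ₘ 0ℤ → a ≡ₘ 0ℤ
  +-cancelʳ-≡ₘ0 {a} {b} a+b≡0 b≡0 = ≡ₘ-trans (≡ₘ-reflexive (cancel a b)) (+-cong a+b≡0 (-‿cong b≡0))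
    where
    cancel : ∀ a b → a ≡ a ℤ.+ b ℤ.+ ℤ.- b
    cancel = solve-∀

  ≡ₘ-setoid : Setoid 0ℓ 0ℓ
  ≡ₘ-setoid = record
    { Carrier       = ℤ
    ; _≈_           = _≡ₘ_
    ; isEquivalence = record { refl = ≡ₘ-refl ; sym = ≡ₘ-sym ; trans = ≡ₘ-trans }
    }

  module ≡ₘ-Reasoning = SetoidReasoning ≡ₘ-setoid

  ^-cong : ∀ {a b} k → a ≡ₘ b → a ℤ.^ k ≡ₘ b ℤ.^ k
  ^-cong zero    a≡b = ≡ₘ-refl
  ^-cong (suc k) a≡b = *-cong a≡b (^-cong k a≡b)

  ∣⇒≡ₘ0 : ∀ {a} → m ℤ.∣ a → a ≡ₘ 0ℤ
  ∣⇒≡ₘ0 {a} m∣a = ≡ₘ-intro (subst (m ℤ.∣_) (sym (ℤ.+-identityʳ a)) m∣a)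

  ≡ₘ0⇒∣ : ∀ {a} → a ≡ₘ 0ℤ → m ℤ.∣ a
  ≡ₘ0⇒∣ {a} (≡ₘ-intro m∣a-0) = subst (m ℤ.∣_) (ℤ.+-identityʳ a) m∣a-0

  sumFrom1-congₘ : ∀ n {f g} → (∀ t → f t ≡ₘ g t) → sumFrom1 n f ≡ₘ sumFrom1 n g
  sumFrom1-congₘ zero    f≡g = ≡ₘ-refl
  sumFrom1-congₘ (suc n) f≡g = +-cong (sumFrom1-congₘ n f≡g) (f≡g (suc n))

  _≋ₘ_ : Series → Series → Set
  f ≋ₘ g = ∀ n → f n ≡ₘ g n

  ≋⇒≋ₘ : ∀ {f g} → f ≋ g → f ≋ₘ g
  ≋⇒≋ₘ f≋g n = ≡ₘ-reflexive (coeff f≋g n)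

  ≋ₘ-sym : ∀ {f g} → f ≋ₘ g → g ≋ₘ f
  ≋ₘ-sym f≡g n = ≡ₘ-sym (f≡g n)

  ≋ₘ-trans : ∀ {f g h} → f ≋ₘ g → g ≋ₘ h → f ≋ₘ h
  ≋ₘ-trans f≡g g≡h n = ≡ₘ-trans (f≡g n) (g≡h n)

  ⊕-congₘ : ∀ {f f′ g g′} → f ≋ₘ f′ → g ≋ₘ g′ → f ⊕ g ≋ₘ f′ ⊕ g′
  ⊕-congₘ f≡f′ g≡g′ n = +-cong (f≡f′ n) (g≡g′ n)

  ⊝-congₘ : ∀ {f f′} → f ≋ₘ f′ → ⊝ f ≋ₘ ⊝ f′
  ⊝-congₘ f≡f′ n = -‿cong (f≡f′ n)

  ∙-congₘ : ∀ c {f f′} → f ≋ₘ f′ → c ∙ f ≋ₘ c ∙ f′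
  ∙-congₘ c f≡f′ n = *-cong (≡ₘ-refl {c}) (f≡f′ n)

  ∣⇒∙≋ₘ𝟘 : ∀ {c} f → m ℤ.∣ c → c ∙ f ≋ₘ 𝟘
  ∣⇒∙≋ₘ𝟘 f m∣c n = ∣⇒≡ₘ0 (ℤ.∣m⇒∣m*n (f n) m∣c)

  ⊛-congₘ : ∀ {f f′ g g′} → f ≋ₘ f′ → g ≋ₘ g′ → f ⊛ g ≋ₘ f′ ⊛ g′
  ⊛-congₘ f≡f′ g≡g′ zero    = *-cong (f≡f′ 0) (g≡g′ 0)
  ⊛-congₘ f≡f′ g≡g′ (suc n) = +-cong (*-cong (f≡f′ 0) (g≡g′ (suc n))) (⊛-congₘ (f≡f′ ∘ suc) g≡g′ n)

  ≋ₘ-intro : ∀ {f g} h → f ≋ g ⊕ m ∙ h → f ≋ₘ g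
  ≋ₘ-intro {f} {g} h f≋g+mh n = ≡ₘ-intro (subst (m ℤ.∣_) m*hₙ≡fₙ-gₙ (ℤ.∣m⇒∣m*n (h n) ℤ.∣-refl))
    where
    difference : ∀ a b → b ≡ a ℤ.+ b ℤ.- a
    difference = solve-∀
    m*hₙ≡fₙ-gₙ : m ℤ.* h n ≡ f n ℤ.- g n
    m*hₙ≡fₙ-gₙ = trans (difference (g n) (m ℤ.* h n)) (cong (ℤ._- g n) (sym (coeff f≋g+mh n)))

-- Partitions

infix 9 𝟙-X^_

𝟙-X^_ : ℕ → Series
𝟙-X^ a = 𝟙 ⊕ ⊝ X^ a

qPoch : ℕ → Series
qPoch zero    = 𝟙
qPoch (suc k) = qPoch k ⊛ 𝟙-X^ suc k

partsFuel-zero : ∀ f k → partsFuel f 0 k ≡ 1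
partsFuel-zero f       zero    = refl
partsFuel-zero zero    (suc k) = refl
partsFuel-zero (suc f) (suc k) = trans (ℕ.+-identityʳ _) (partsFuel-zero (suc f) k)

partsFuel-fuel : ∀ f g n k → n ≤ f → n ≤ g → partsFuel f n k ≡ partsFuel g n k
partsFuel-fuel f g zero k _ _ = trans (partsFuel-zero f k) (sym (partsFuel-zero g k))
partsFuel-fuel f g (suc n) zero _ _ = refl
partsFuel-fuel (suc f) (suc g) (suc n) (suc k) n<f n<g with suc n ℕ.<ᵇ suc k
... | true  = cong (ℕ._+ 0) (partsFuel-fuel (suc f) (suc g) (suc n) k n<f n<g)
... | false = cong₂ _+_ (partsFuel-fuel (suc f) (suc g) (suc n) k n<f n<g)
                        (partsFuel-fuel f g (n ∸ k) (suc k) (ℕ.≤-trans (ℕ.m∸n≤m n k) (ℕ.≤-pred n<f))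
                                                            (ℕ.≤-trans (ℕ.m∸n≤m n k) (ℕ.≤-pred n<g)))

P≤ : ℕ → Series
P≤ k n = + partsFuel n n k

P≤-suc-coeff : ∀ k n → P≤ (suc k) n ≡ P≤ k n ℤ.+ (X^ suc k ⊛ P≤ (suc k)) n
P≤-suc-coeff k zero = sym (trans (ℤ.+-identityʳ _) (cong +_ (partsFuel-zero 0 k)))
P≤-suc-coeff k (suc n) with suc n ℕ.<ᵇ suc k in n<ᵇk
... | true  = begin
  + (partsFuel (suc n) (suc n) k + 0)
    ≡⟨ cong +_ (ℕ.+-identityʳ _) ⟩
  P≤ k (suc n)
    ≡⟨ ℤ.+-identityʳ _ ⟨
  P≤ k (suc n) ℤ.+ 0ℤ
    ≡⟨ cong (ℤ._+_ (P≤ k (suc n))) (X^-⊛-below (suc k) (P≤ (suc k)) n<k) ⟨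
  P≤ k (suc n) ℤ.+ (X^ suc k ⊛ P≤ (suc k)) (suc n) ∎
  where
  open ≡-Reasoning
  n<k : suc n < suc k
  n<k = ℕ.<ᵇ⇒< (suc n) (suc k) (subst Bool.T (sym n<ᵇk) tt)
... | false = begin
  + (partsFuel (suc n) (suc n) k + partsFuel n (n ∸ k) (suc k))
    ≡⟨ ℤ.pos-+ (partsFuel (suc n) (suc n) k) (partsFuel n (n ∸ k) (suc k)) ⟩
  P≤ k (suc n) ℤ.+ + partsFuel n (n ∸ k) (suc k)
    ≡⟨ cong (λ x → P≤ k (suc n) ℤ.+ + x) (partsFuel-fuel n (n ∸ k) (n ∸ k) (suc k) (ℕ.m∸n≤m n k) ℕ.≤-refl) ⟩
  P≤ k (suc n) ℤ.+ P≤ (suc k) (n ∸ k)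
    ≡⟨ cong (ℤ._+_ (P≤ k (suc n))) (X^-⊛-shift (suc k) (P≤ (suc k)) (n ∸ k)) ⟨
  P≤ k (suc n) ℤ.+ (X^ suc k ⊛ P≤ (suc k)) (suc k + (n ∸ k))
    ≡⟨ cong (λ i → P≤ k (suc n) ℤ.+ (X^ suc k ⊛ P≤ (suc k)) i) (cong suc (ℕ.m+[n∸m]≡n k≤n)) ⟩
  P≤ k (suc n) ℤ.+ (X^ suc k ⊛ P≤ (suc k)) (suc n) ∎
  where
  open ≡-Reasoning
  k≤n : k ≤ n
  k≤n = ℕ.≤-pred (ℕ.≮⇒≥ (λ n<k → subst Bool.T n<ᵇk (ℕ.<⇒<ᵇ n<k)))

P≤-⊛-𝟙-X^ : ∀ k → P≤ (suc k) ⊛ 𝟙-X^ suc k ≋ P≤ k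
P≤-⊛-𝟙-X^ k = begin
  P′ ⊛ (𝟙 ⊕ ⊝ X)                   ≈⟨ solve 2 (λ P′ X → P′ :* (con 1ℤ :- X) := P′ :- X :* P′) ≋-refl P′ X ⟩
  P′ ⊕ ⊝ (X ⊛ P′)                  ≈⟨ ⊕-cong (mk≋ (P≤-suc-coeff k)) ≋-refl ⟩
  P≤ k ⊕ X ⊛ P′ ⊕ ⊝ (X ⊛ P′)        ≈⟨ solve 2 (λ P XP′ → P :+ XP′ :- XP′ := P) ≋-refl (P≤ k) (X ⊛ P′) ⟩
  P≤ k ∎
  where
  open ≋-Reasoning
  P′ = P≤ (suc k)
  X  = X^ suc k

qPoch-⊛-P≤ : ∀ k → qPoch k ⊛ P≤ k ≋ 𝟙
qPoch-⊛-P≤ zero    = ≋-trans (⊛-identityˡ (P≤ 0)) (mk≋ λ { zero → refl ; (suc n) → refl })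
qPoch-⊛-P≤ (suc k) = begin
  qPoch k ⊛ 𝟙-X^ suc k ⊛ P≤ (suc k)
    ≈⟨ solve 3 (λ E L P → E :* L :* P := E :* (P :* L)) ≋-refl (qPoch k) (𝟙-X^ suc k) (P≤ (suc k)) ⟩
  qPoch k ⊛ (P≤ (suc k) ⊛ 𝟙-X^ suc k)
    ≈⟨ ⊛-congˡ (P≤-⊛-𝟙-X^ k) ⟩
  qPoch k ⊛ P≤ k
    ≈⟨ qPoch-⊛-P≤ k ⟩
  𝟙 ∎
  where open ≋-Reasoning

P≤-stable : ∀ {k n} → n ≤ k → P≤ (suc k) n ≡ P≤ k n
P≤-stable {k} {n} n≤k = begin
  P≤ (suc k) n
    ≡⟨ P≤-suc-coeff k n ⟩
  P≤ k n ℤ.+ (X^ suc k ⊛ P≤ (suc k)) n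
    ≡⟨ cong (ℤ._+_ (P≤ k n)) (X^-⊛-below (suc k) (P≤ (suc k)) (s≤s n≤k)) ⟩
  P≤ k n ℤ.+ 0ℤ
    ≡⟨ ℤ.+-identityʳ _ ⟩
  P≤ k n ∎
  where open ≡-Reasoning

P≤-coeff : ∀ {k n} → n ≤ k → P≤ k n ≡ + p n
P≤-coeff = go ∘ ℕ.≤⇒≤′
  where
  go : ∀ {k n} → n ℕ.≤′ k → P≤ k n ≡ + p n
  go ℕ.≤′-refl         = refl
  go (ℕ.≤′-step n≤′k) = trans (P≤-stable (ℕ.≤′⇒≤ n≤′k)) (go n≤′k)

-- Euler's identity n p(n) = Σ σ(t) p(n - t)

θ : Series → Series
θ f n = + n ℤ.* f n

θ-⊛ : ∀ f g → θ (f ⊛ g) ≋ θ f ⊛ g ⊕ f ⊛ θ g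
θ-⊛ f g = mk≋ (go f)
  where
  tail-θ : ∀ f → tail (θ f) ≋ tail f ⊕ θ (tail f)
  tail-θ f = mk≋ (λ n → trans (ℤ.*-distribʳ-+ (f (suc n)) 1ℤ (+ n))
                              (cong (ℤ._+ (+ n ℤ.* f (suc n))) (ℤ.*-identityˡ (f (suc n)))))

  go : ∀ f n → θ (f ⊛ g) n ≡ (θ f ⊛ g ⊕ f ⊛ θ g) n
  go f zero    = sym (trans (ℤ.+-identityˡ _) (ℤ.*-zeroʳ (f 0)))
  go f (suc n) = begin
    (1ℤ ℤ.+ N) ℤ.* (a ℤ.* b ℤ.+ c)
      ≡⟨ expand N a b c ⟩
    (1ℤ ℤ.+ N) ℤ.* a ℤ.* b ℤ.+ c ℤ.+ N ℤ.* c
      ≡⟨ cong (ℤ._+_ ((1ℤ ℤ.+ N) ℤ.* a ℤ.* b ℤ.+ c)) (go (tail f) n) ⟩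
    (1ℤ ℤ.+ N) ℤ.* a ℤ.* b ℤ.+ c ℤ.+ (d ℤ.+ e)
      ≡⟨ regroup N a b c d e ⟩
    0ℤ ℤ.+ (c ℤ.+ d) ℤ.+ (a ℤ.* ((1ℤ ℤ.+ N) ℤ.* b) ℤ.+ e)
      ≡⟨ cong (λ x → 0ℤ ℤ.+ x ℤ.+ (a ℤ.* ((1ℤ ℤ.+ N) ℤ.* b) ℤ.+ e)) (coeff tail-θf⊛g n) ⟨
    (θ f ⊛ g ⊕ f ⊛ θ g) (suc n) ∎
    where
    open ≡-Reasoning
    N = + n
    a = f 0
    b = g (suc n)
    c = (tail f ⊛ g) n
    d = (θ (tail f) ⊛ g) n
    e = (tail f ⊛ θ g) n
    tail-θf⊛g : tail (θ f) ⊛ g ≋ tail f ⊛ g ⊕ θ (tail f) ⊛ g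
    tail-θf⊛g = ≋-trans (⊛-congʳ (tail-θ f)) (⊛-distribʳ g (tail f) (θ (tail f)))
    expand : ∀ N a b c → (1ℤ ℤ.+ N) ℤ.* (a ℤ.* b ℤ.+ c) ≡ (1ℤ ℤ.+ N) ℤ.* a ℤ.* b ℤ.+ c ℤ.+ N ℤ.* c
    expand = solve-∀
    regroup : ∀ N a b c d e → (1ℤ ℤ.+ N) ℤ.* a ℤ.* b ℤ.+ c ℤ.+ (d ℤ.+ e)
                            ≡ 0ℤ ℤ.+ (c ℤ.+ d) ℤ.+ (a ℤ.* ((1ℤ ℤ.+ N) ℤ.* b) ℤ.+ e)
    regroup = solve-∀

θ-cong : ∀ {f g} → f ≋ g → θ f ≋ θ g
θ-cong f≋g = mk≋ (λ n → cong (ℤ._*_ (+ n)) (coeff f≋g n))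

θ-X^ : ∀ a → θ (X^ a) ≋ (+ a) ∙ X^ a
θ-X^ a = mk≋ go
  where
  go : ∀ n → + n ℤ.* (X^ a) n ≡ + a ℤ.* (X^ a) n
  go n with n ℕ.≟ a
  ... | yes refl = refl
  ... | no n≢a rewrite X^-coeff-≢ a n≢a = trans (ℤ.*-zeroʳ (+ n)) (sym (ℤ.*-zeroʳ (+ a)))

θ-𝟙-X^ : ∀ a → θ (𝟙-X^ a) ≋ ⊝ ((+ a) ∙ X^ a)
θ-𝟙-X^ a = mk≋ λ n → begin
  + n ℤ.* (𝟙 n ℤ.- (X^ a) n)
    ≡⟨ ℤ.*-distribˡ-+ (+ n) (𝟙 n) (ℤ.- (X^ a) n) ⟩
  + n ℤ.* 𝟙 n ℤ.+ + n ℤ.* ℤ.- (X^ a) n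
    ≡⟨ cong₂ ℤ._+_ (θ-𝟙 n) (sym (ℤ.neg-distribʳ-* (+ n) ((X^ a) n))) ⟩
  0ℤ ℤ.+ ℤ.- (+ n ℤ.* (X^ a) n)
    ≡⟨ ℤ.+-identityˡ _ ⟩
  ℤ.- (+ n ℤ.* (X^ a) n)
    ≡⟨ cong ℤ.-_ (coeff (θ-X^ a) n) ⟩
  ℤ.- (+ a ℤ.* (X^ a) n) ∎
  where
  open ≡-Reasoning
  θ-𝟙 : ∀ n → + n ℤ.* 𝟙 n ≡ 0ℤ
  θ-𝟙 zero    = refl
  θ-𝟙 (suc n) = ℤ.*-zeroʳ (+ suc n)

geometric : ℕ → Series
geometric a n = if does (a ∣? n) then 1ℤ else 0ℤ

geometric-shift : ∀ a r → geometric a (a + r) ≡ geometric a r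
geometric-shift a r with a ∣? (a + r) | a ∣? r
... | yes _   | yes _   = refl
... | no _    | no _    = refl
... | yes a∣a+r | no a∤r  = ⊥-elim (a∤r (ℕ.∣m+n∣m⇒∣n a∣a+r ℕ.∣-refl))
... | no a∤a+r  | yes a∣r = ⊥-elim (a∤a+r (ℕ.∣m∣n⇒∣m+n ℕ.∣-refl a∣r))

geometric-below : ∀ a {n} → 0 < n → n < a → geometric a n ≡ 0ℤ
geometric-below a {n} 0<n n<a with a ∣? n
... | yes a∣n = ⊥-elim (ℕ.<⇒≱ n<a (ℕ.∣⇒≤ {{ℕ.>-nonZero 0<n}} a∣n))
... | no _    = refl

X^-⊛-geometric : ∀ a {t} → 0 < t → (X^ a ⊛ geometric a) t ≡ geometric a t
X^-⊛-geometric a {t} 0<t with t ℕ.<? a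
... | yes t<a = trans (X^-⊛-below a (geometric a) t<a) (sym (geometric-below a 0<t t<a))
... | no t≮a  = begin
  (X^ a ⊛ geometric a) t         ≡⟨ cong (X^ a ⊛ geometric a) a+r≡t ⟨
  (X^ a ⊛ geometric a) (a + r)   ≡⟨ X^-⊛-shift a (geometric a) r ⟩
  geometric a r                  ≡⟨ geometric-shift a r ⟨
  geometric a (a + r)            ≡⟨ cong (geometric a) a+r≡t ⟩
  geometric a t                  ∎
  where
  open ≡-Reasoning
  r = t ∸ a
  a+r≡t : a + r ≡ t
  a+r≡t = ℕ.m+[n∸m]≡n (ℕ.≮⇒≥ t≮a)

geometric-⊛-𝟙-X^ : ∀ k → geometric (suc k) ⊛ 𝟙-X^ suc k ≋ 𝟙
geometric-⊛-𝟙-X^ k = ≋-trans (solve 2 (λ G X → G :* (con 1ℤ :- X) := G :- X :* G) ≋-refl G (X^ a)) (mk≋ go)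
  where
  a = suc k
  G = geometric a
  go : ∀ n → G n ℤ.- (X^ a ⊛ G) n ≡ 𝟙 n
  go zero    = refl
  go (suc n) = trans (cong (λ x → G (suc n) ℤ.- x) (X^-⊛-geometric a (s≤s z≤n))) (ℤ.+-inverseʳ (G (suc n)))

divisorSeries : ℕ → Series
divisorSeries zero    = 𝟘
divisorSeries (suc k) = divisorSeries k ⊕ (+ suc k) ∙ X^ suc k ⊛ geometric (suc k)

θ-P≤ : ∀ k → θ (P≤ k) ≋ P≤ k ⊛ divisorSeries k
θ-P≤ zero    = ≋-trans (mk≋ θ-P≤0) (≋-sym (⊛-zeroʳ (P≤ 0)))
  where
  θ-P≤0 : ∀ n → θ (P≤ 0) n ≡ 0ℤ
  θ-P≤0 zero    = refl
  θ-P≤0 (suc n) = ℤ.*-zeroʳ (+ suc n)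
θ-P≤ (suc k) = begin
  θ P′                                      ≈⟨ ⊛-identityʳ (θ P′) ⟨
  θ P′ ⊛ 𝟙                                  ≈⟨ ⊛-congˡ L⊛G≋𝟙 ⟨
  θ P′ ⊛ (L ⊛ G)                            ≈⟨ ⊛-assoc (θ P′) L G ⟨
  θ P′ ⊛ L ⊛ G                              ≈⟨ ⊛-congʳ θP′⊛L ⟩
  (P′ ⊛ L ⊛ divisorSeries k ⊕ P′ ⊛ Y) ⊛ G    ≈⟨ distribute P′ L (divisorSeries k) Y G ⟩
  P′ ⊛ (divisorSeries k ⊛ (L ⊛ G) ⊕ Y ⊛ G)   ≈⟨ ⊛-congˡ (⊕-cong (⊛-congˡ L⊛G≋𝟙) ≋-refl) ⟩
  P′ ⊛ (divisorSeries k ⊛ 𝟙 ⊕ Y ⊛ G)        ≈⟨ ⊛-congˡ (⊕-cong (⊛-identityʳ (divisorSeries k)) ≋-refl) ⟩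
  P′ ⊛ divisorSeries (suc k)                ∎
  where
  open ≋-Reasoning
  P′ = P≤ (suc k)
  L  = 𝟙-X^ suc k
  G  = geometric (suc k)
  Y  = (+ suc k) ∙ X^ suc k
  L⊛G≋𝟙 : L ⊛ G ≋ 𝟙
  L⊛G≋𝟙 = ≋-trans (⊛-comm L G) (geometric-⊛-𝟙-X^ k)
  distribute : ∀ P L S Y G → (P ⊛ L ⊛ S ⊕ P ⊛ Y) ⊛ G ≋ P ⊛ (S ⊛ (L ⊛ G) ⊕ Y ⊛ G)
  distribute = solve 5 (λ P L S Y G → (P :* L :* S :+ P :* Y) :* G := P :* (S :* (L :* G) :+ Y :* G)) ≋-refl
  θP′⊛L : θ P′ ⊛ L ≋ P′ ⊛ L ⊛ divisorSeries k ⊕ P′ ⊛ Y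
  θP′⊛L = begin
    θ P′ ⊛ L
      ≈⟨ solve 3 (λ D P Y → D := D :+ P :* (:- Y) :+ P :* Y) ≋-refl (θ P′ ⊛ L) P′ Y ⟩
    θ P′ ⊛ L ⊕ P′ ⊛ ⊝ Y ⊕ P′ ⊛ Y
      ≈⟨ ⊕-cong (⊕-cong (≋-refl {θ P′ ⊛ L}) (⊛-congˡ (θ-𝟙-X^ (suc k)))) (≋-refl {P′ ⊛ Y}) ⟨
    θ P′ ⊛ L ⊕ P′ ⊛ θ L ⊕ P′ ⊛ Y
      ≈⟨ ⊕-cong (θ-⊛ P′ L) ≋-refl ⟨
    θ (P′ ⊛ L) ⊕ P′ ⊛ Y
      ≈⟨ ⊕-cong (θ-cong (P≤-⊛-𝟙-X^ k)) ≋-refl ⟩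
    θ (P≤ k) ⊕ P′ ⊛ Y
      ≈⟨ ⊕-cong (≋-trans (θ-P≤ k) (⊛-congʳ (≋-sym (P≤-⊛-𝟙-X^ k)))) ≋-refl ⟩
    P′ ⊛ L ⊛ divisorSeries k ⊕ P′ ⊛ Y ∎

sumFrom1-cong : ∀ n {f g} → (∀ t → 1 ≤ t → t ≤ n → f t ≡ g t) → sumFrom1 n f ≡ sumFrom1 n g
sumFrom1-cong zero    f≡g = refl
sumFrom1-cong (suc n) f≡g = cong₂ ℤ._+_ (sumFrom1-cong n (λ t 1≤t t≤n → f≡g t 1≤t (ℕ.m≤n⇒m≤1+n t≤n)))
                                        (f≡g (suc n) (s≤s z≤n) ℕ.≤-refl)

sumFrom1-extend : ∀ f {n k} → n ≤ k → (∀ d → n < d → f d ≡ 0ℤ) → sumFrom1 k f ≡ sumFrom1 n f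
sumFrom1-extend f {n} n≤k vanish = go (ℕ.≤⇒≤′ n≤k)
  where
  go : ∀ {k} → n ℕ.≤′ k → sumFrom1 k f ≡ sumFrom1 n f
  go ℕ.≤′-refl                 = refl
  go (ℕ.≤′-step {k} n≤′k) = trans (cong (ℤ._+_ (sumFrom1 k f)) (vanish (suc k) (s≤s (ℕ.≤′⇒≤ n≤′k))))
                                  (trans (ℤ.+-identityʳ (sumFrom1 k f)) (go n≤′k))

⊛-coeff-sumFrom1 : ∀ f g n → (f ⊛ g) n ≡ f 0 ℤ.* g n ℤ.+ sumFrom1 n (λ t → f t ℤ.* g (n ∸ t))
⊛-coeff-sumFrom1 f g zero    = sym (ℤ.+-identityʳ _)
⊛-coeff-sumFrom1 f g (suc n) = begin
  (f ⊛ g) (suc n)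
    ≡⟨ ⊛-sucʳ f g n ⟩
  (f ⊛ tail g) n ℤ.+ f (suc n) ℤ.* g 0
    ≡⟨ cong (ℤ._+ f (suc n) ℤ.* g 0) (⊛-coeff-sumFrom1 f (tail g) n) ⟩
  f 0 ℤ.* g (suc n) ℤ.+ sumFrom1 n (λ t → f t ℤ.* g (suc (n ∸ t))) ℤ.+ f (suc n) ℤ.* g 0
    ≡⟨ ℤ.+-assoc (f 0 ℤ.* g (suc n)) _ _ ⟩
  f 0 ℤ.* g (suc n) ℤ.+ (sumFrom1 n (λ t → f t ℤ.* g (suc (n ∸ t))) ℤ.+ f (suc n) ℤ.* g 0)
    ≡⟨ cong (ℤ._+_ (f 0 ℤ.* g (suc n))) (cong₂ ℤ._+_ shifted-sum last-term) ⟩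
  f 0 ℤ.* g (suc n) ℤ.+ sumFrom1 (suc n) (λ t → f t ℤ.* g (suc n ∸ t))
    ∎
  where
  open ≡-Reasoning
  shifted-sum : sumFrom1 n (λ t → f t ℤ.* g (suc (n ∸ t))) ≡ sumFrom1 n (λ t → f t ℤ.* g (suc n ∸ t))
  shifted-sum = sumFrom1-cong n (λ t _ t≤n → cong (λ i → f t ℤ.* g i) (sym (ℕ.+-∸-assoc 1 t≤n)))
  last-term : f (suc n) ℤ.* g 0 ≡ f (suc n) ℤ.* g (suc n ∸ suc n)
  last-term = cong (λ i → f (suc n) ℤ.* g i) (sym (ℕ.n∸n≡0 n))

σ₁ : ℕ → ℤ
σ₁ t = sumFrom1 t (λ d → if does (d ∣? t) then + d else 0ℤ)

divisorSeries-coeff : ∀ k {t} → 0 < t → divisorSeries k t ≡ sumFrom1 k (λ d → if does (d ∣? t) then + d else 0ℤ)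
divisorSeries-coeff zero    0<t = refl
divisorSeries-coeff (suc k) {t} 0<t = cong₂ ℤ._+_ (divisorSeries-coeff k 0<t) (begin
  ((+ suc k) ∙ X^ suc k ⊛ geometric (suc k)) t  ≡⟨ coeff (∙-⊛ (+ suc k) (X^ suc k) (geometric (suc k))) t ⟩
  + suc k ℤ.* (X^ suc k ⊛ geometric (suc k)) t  ≡⟨ cong (ℤ._*_ (+ suc k)) (X^-⊛-geometric (suc k) 0<t) ⟩
  + suc k ℤ.* geometric (suc k) t               ≡⟨ scale (does (suc k ∣? t)) ⟩
  (if does (suc k ∣? t) then + suc k else 0ℤ)   ∎)
  where
  open ≡-Reasoning
  scale : ∀ b → + suc k ℤ.* (if b then 1ℤ else 0ℤ) ≡ (if b then + suc k else 0ℤ)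
  scale true  = ℤ.*-identityʳ (+ suc k)
  scale false = ℤ.*-zeroʳ (+ suc k)

divisorSeries-coeff-σ₁ : ∀ {k t} → 0 < t → t ≤ k → divisorSeries k t ≡ σ₁ t
divisorSeries-coeff-σ₁ {k} {t} 0<t t≤k =
  trans (divisorSeries-coeff k 0<t) (sumFrom1-extend (λ d → if does (d ∣? t) then + d else 0ℤ) t≤k non-divisor)
  where
  non-divisor : ∀ d → t < d → (if does (d ∣? t) then + d else 0ℤ) ≡ 0ℤ
  non-divisor d t<d with d ∣? t
  ... | yes d∣t = ⊥-elim (ℕ.<⇒≱ t<d (ℕ.∣⇒≤ {{ℕ.>-nonZero 0<t}} d∣t))
  ... | no _    = refl

divisorSeries-coeff-0 : ∀ k → divisorSeries k 0 ≡ 0ℤ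
divisorSeries-coeff-0 zero    = refl
divisorSeries-coeff-0 (suc k) = begin
  divisorSeries k 0 ℤ.+ ((+ suc k) ∙ X^ suc k ⊛ geometric (suc k)) 0
    ≡⟨ cong₂ ℤ._+_ (divisorSeries-coeff-0 k) (coeff (∙-⊛ (+ suc k) (X^ suc k) (geometric (suc k))) 0) ⟩
  0ℤ ℤ.+ + suc k ℤ.* 0ℤ
    ≡⟨ trans (ℤ.+-identityˡ _) (ℤ.*-zeroʳ (+ suc k)) ⟩
  0ℤ ∎
  where open ≡-Reasoning

euler-recurrence : ∀ n → + n ℤ.* + p n ≡ sumFrom1 n (λ t → σ₁ t ℤ.* + p (n ∸ t))
euler-recurrence n = begin
  + n ℤ.* + p n
    ≡⟨ cong (ℤ._*_ (+ n)) (P≤-coeff {n} ℕ.≤-refl) ⟨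
  θ (P≤ n) n
    ≡⟨ coeff (≋-trans (θ-P≤ n) (⊛-comm (P≤ n) (divisorSeries n))) n ⟩
  (divisorSeries n ⊛ P≤ n) n
    ≡⟨ ⊛-coeff-sumFrom1 (divisorSeries n) (P≤ n) n ⟩
  divisorSeries n 0 ℤ.* P≤ n n ℤ.+ sumFrom1 n (λ t → divisorSeries n t ℤ.* P≤ n (n ∸ t))
    ≡⟨ cong (λ x → x ℤ.* P≤ n n ℤ.+ sumFrom1 n (λ t → divisorSeries n t ℤ.* P≤ n (n ∸ t)))
            (divisorSeries-coeff-0 n) ⟩
  0ℤ ℤ.+ sumFrom1 n (λ t → divisorSeries n t ℤ.* P≤ n (n ∸ t))
    ≡⟨ ℤ.+-identityˡ _ ⟩
  sumFrom1 n (λ t → divisorSeries n t ℤ.* P≤ n (n ∸ t))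
    ≡⟨ sumFrom1-cong n (λ t 1≤t t≤n → cong₂ ℤ._*_ (divisorSeries-coeff-σ₁ 1≤t t≤n) (P≤-coeff (ℕ.m∸n≤m n t))) ⟩
  sumFrom1 n (λ t → σ₁ t ℤ.* + p (n ∸ t))
    ∎
  where open ≡-Reasoning

-- M̂(n) ≡ n p(n) (mod 5)

open Congruence (+ 5)

residue-≡ₘ : ∀ d → + d ≡ₘ + (d % 5)
residue-≡ₘ d = ≡ₘ-intro (ℤ.divides (+ q) (begin
  + d ℤ.- + r
    ≡⟨ cong (λ x → + x ℤ.- + r) (ℕ.m≡m%n+[m/n]*n d 5) ⟩
  + (r + q * 5) ℤ.- + r
    ≡⟨ cong (ℤ._- + r) (trans (ℤ.pos-+ r (q * 5)) (cong (ℤ._+_ (+ r)) (ℤ.pos-* q 5))) ⟩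
  + r ℤ.+ + q ℤ.* + 5 ℤ.- + r
    ≡⟨ cancel (+ r) (+ q) ⟩
  + q ℤ.* + 5 ∎))
  where
  open ≡-Reasoning
  r = d % 5
  q = d / 5
  cancel : ∀ r q → r ℤ.+ q ℤ.* + 5 ℤ.- r ≡ q ℤ.* + 5
  cancel = solve-∀

cube-from-residue : ∀ c d {r} → d % 5 ≡ r → c ℤ.* (+ r) ℤ.^ 3 ≡ₘ + r → c ℤ.* (+ d) ℤ.^ 3 ≡ₘ + d
cube-from-residue c d d%5≡r holds-for-r =
  ≡ₘ-trans (*-cong (≡ₘ-refl {c}) (^-cong 3 d≡r)) (≡ₘ-trans holds-for-r (≡ₘ-sym d≡r))
  where
  d≡r : + d ≡ₘ + _
  d≡r = subst (λ r → + d ≡ₘ + r) d%5≡r (residue-≡ₘ d)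

χ₅-cube : ∀ d → χ₅ d ℤ.* (+ d) ℤ.^ 3 ≡ₘ + d
χ₅-cube d with d % 5 in d%5≡r
... | 0 = cube-from-residue 0ℤ d d%5≡r ≡ₘ-refl
... | 1 = cube-from-residue 1ℤ d d%5≡r ≡ₘ-refl
... | 2 = cube-from-residue (ℤ.- 1ℤ) d d%5≡r (≡ₘ-intro (ℤ.divides (ℤ.- + 2) refl))
... | 3 = cube-from-residue (ℤ.- 1ℤ) d d%5≡r (≡ₘ-intro (ℤ.divides (ℤ.- + 6) refl))
... | 4 = cube-from-residue 1ℤ d d%5≡r (≡ₘ-intro (ℤ.divides (+ 12) refl))
... | suc (suc (suc (suc (suc _)))) = ⊥-elim (ℕ.<⇒≱ (ℕ.m%n<n d 5) (subst (5 ≤_) (sym d%5≡r) (ℕ.m≤m+n 5 _)))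

σχ₅₃≡ₘσ₁ : ∀ t → σχ₅₃ t ≡ₘ σ₁ t
σχ₅₃≡ₘσ₁ t = sumFrom1-congₘ t term
  where
  term : ∀ d → (if does (d ∣? t) then χ₅ d ℤ.* (+ d) ℤ.^ 3 else 0ℤ) ≡ₘ (if does (d ∣? t) then + d else 0ℤ)
  term d with d ∣? t
  ... | yes _ = χ₅-cube d
  ... | no _  = ≡ₘ-refl

Mχ₅₃≡ₘn*p : ∀ n → Mχ₅₃ n ≡ₘ + n ℤ.* + p n
Mχ₅₃≡ₘn*p n = ≡ₘ-trans (sumFrom1-congₘ n (λ t → *-cong (σχ₅₃≡ₘσ₁ t) ≡ₘ-refl))
                       (≡ₘ-reflexive (sym (euler-recurrence n)))

-- Gaussian polynomials

qBinom : ℕ → ℕ → Series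
qBinom N       zero    = 𝟙
qBinom zero    (suc j) = 𝟘
qBinom (suc N) (suc j) = qBinom N j ⊕ X^ suc j ⊛ qBinom N (suc j)

qBinom-above : ∀ {N j} → N < j → qBinom N j ≋ 𝟘
qBinom-above {zero}  {suc j} _           = ≋-refl
qBinom-above {suc N} {suc j} (s≤s N<j) = begin
  qBinom N j ⊕ X^ suc j ⊛ qBinom N (suc j)
    ≈⟨ ⊕-cong (qBinom-above N<j) (⊛-congˡ (qBinom-above (ℕ.m≤n⇒m≤1+n N<j))) ⟩
  𝟘 ⊕ X^ suc j ⊛ 𝟘
    ≈⟨ ≋-trans (⊕-identityˡ _) (⊛-zeroʳ _) ⟩
  𝟘 ∎
  where open ≋-Reasoning

qBinom-diag : ∀ N → qBinom N N ≋ 𝟙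
qBinom-diag zero    = ≋-refl
qBinom-diag (suc N) = begin
  qBinom N N ⊕ X^ suc N ⊛ qBinom N (suc N)   ≈⟨ ⊕-cong (qBinom-diag N) (⊛-congˡ (qBinom-above {N} ℕ.≤-refl)) ⟩
  𝟙 ⊕ X^ suc N ⊛ 𝟘                           ≈⟨ ≋-trans (⊕-cong (≋-refl {𝟙}) (⊛-zeroʳ _)) (⊕-identityʳ 𝟙) ⟩
  𝟙                                          ∎
  where open ≋-Reasoning

X^-⊛-qBinom : ∀ {a b} N j → (j ≤ N → a ≡ b) → X^ a ⊛ qBinom N j ≋ X^ b ⊛ qBinom N j
X^-⊛-qBinom {a} {b} N j a≡b with j ℕ.≤? N
... | yes j≤N = ⊛-congʳ (≋-reflexive (cong X^_ (a≡b j≤N)))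
... | no  j≰N = ≋-trans (vanish a) (≋-sym (vanish b))
  where
  vanish : ∀ c → X^ c ⊛ qBinom N j ≋ 𝟘
  vanish c = ≋-trans (⊛-congˡ (qBinom-above (ℕ.≰⇒> j≰N))) (⊛-zeroʳ _)

qBinom-pascal′ : ∀ N j → qBinom (suc N) (suc j) ≋ X^ (N ∸ j) ⊛ qBinom N j ⊕ qBinom N (suc j)
qBinom-pascal′ zero    zero    = ⊕-cong (≋-sym (⊛-identityˡ 𝟙)) (⊛-zeroʳ (X^ 1))
qBinom-pascal′ zero    (suc j) = ⊕-cong (≋-sym (⊛-zeroʳ 𝟙)) (⊛-zeroʳ (X^ (2 + j)))
qBinom-pascal′ (suc N) zero    = begin
  𝟙 ⊕ X^ 1 ⊛ qBinom (suc N) 1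
    ≈⟨ ⊕-cong (≋-refl {𝟙}) (⊛-congˡ (qBinom-pascal′ N 0)) ⟩
  𝟙 ⊕ X^ 1 ⊛ (X^ N ⊛ 𝟙 ⊕ B)
    ≈⟨ solve 3 (λ X Xᴺ B → con 1ℤ :+ X :* (Xᴺ :* con 1ℤ :+ B)
                             := (X :* Xᴺ) :* con 1ℤ :+ (con 1ℤ :+ X :* B))
             ≋-refl (X^ 1) (X^ N) B ⟩
  (X^ 1 ⊛ X^ N) ⊛ 𝟙 ⊕ (𝟙 ⊕ X^ 1 ⊛ B)
    ≈⟨ ⊕-cong (⊛-congʳ (X^-+ 1 N)) (≋-refl {𝟙 ⊕ X^ 1 ⊛ B}) ⟩
  X^ suc N ⊛ 𝟙 ⊕ (𝟙 ⊕ X^ 1 ⊛ B) ∎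
  where
  open ≋-Reasoning
  B = qBinom N 1
qBinom-pascal′ (suc N) (suc j) = begin
  qBinom (suc N) (suc j) ⊕ X^ (2 + j) ⊛ qBinom (suc N) (2 + j)
    ≈⟨ ⊕-cong (qBinom-pascal′ N j) (⊛-congˡ (qBinom-pascal′ N (suc j))) ⟩
  X^ (N ∸ j) ⊛ A ⊕ B ⊕ X^ (2 + j) ⊛ (X^ (N ∸ suc j) ⊛ B ⊕ C)
    ≈⟨ solve 6 (λ Xa A B Xb Xc C → Xa :* A :+ B :+ Xb :* (Xc :* B :+ C)
                                := Xa :* A :+ B :+ (Xb :* Xc) :* B :+ Xb :* C)
             ≋-refl (X^ (N ∸ j)) A B (X^ (2 + j)) (X^ (N ∸ suc j)) C ⟩
  X^ (N ∸ j) ⊛ A ⊕ B ⊕ (X^ (2 + j) ⊛ X^ (N ∸ suc j)) ⊛ B ⊕ X^ (2 + j) ⊛ C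
    ≈⟨ ⊕-cong (⊕-cong (≋-refl {X^ (N ∸ j) ⊛ A ⊕ B}) middle) (≋-refl {X^ (2 + j) ⊛ C}) ⟩
  X^ (N ∸ j) ⊛ A ⊕ B ⊕ (X^ (N ∸ j) ⊛ X^ (suc j)) ⊛ B ⊕ X^ (2 + j) ⊛ C
    ≈⟨ solve 6 (λ Xa A B Xb Xc C → Xa :* A :+ B :+ (Xa :* Xc) :* B :+ Xb :* C
                                := Xa :* (A :+ Xc :* B) :+ (B :+ Xb :* C))
             ≋-refl (X^ (N ∸ j)) A B (X^ (2 + j)) (X^ (suc j)) C ⟩
  X^ (N ∸ j) ⊛ qBinom (suc N) (suc j) ⊕ qBinom (suc N) (2 + j)
    ∎
  where
  open ≋-Reasoning
  A = qBinom N j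
  B = qBinom N (suc j)
  C = qBinom N (2 + j)
  exponents : suc j ≤ N → 2 + j + (N ∸ suc j) ≡ N ∸ j + suc j
  exponents j<N = trans (cong suc (ℕ.m+[n∸m]≡n j<N))
                        (sym (trans (ℕ.+-suc (N ∸ j) j) (cong suc (ℕ.m∸n+n≡m (ℕ.<⇒≤ j<N)))))
  middle : (X^ (2 + j) ⊛ X^ (N ∸ suc j)) ⊛ B ≋ (X^ (N ∸ j) ⊛ X^ (suc j)) ⊛ B
  middle = ≋-trans (⊛-congʳ (X^-+ (2 + j) (N ∸ suc j)))
             (≋-trans (X^-⊛-qBinom N (suc j) exponents) (⊛-congʳ (≋-sym (X^-+ (N ∸ j) (suc j)))))

qBinom-qPoch : ∀ {N j} → j ≤ N → qBinom N j ⊛ qPoch j ⊛ qPoch (N ∸ j) ≋ qPoch N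
qBinom-qPoch {N} {zero} _ = solve 1 (λ E → con 1ℤ :* con 1ℤ :* E := E) ≋-refl (qPoch N)
qBinom-qPoch {suc N} {suc j} (s≤s j≤N) with ℕ.m≤n⇒m<n∨m≡n j≤N
... | inj₂ refl = begin
  qBinom (suc N) (suc N) ⊛ qPoch (suc N) ⊛ qPoch (N ∸ N)
    ≈⟨ ⊛-cong (⊛-congʳ (qBinom-diag (suc N))) (≋-reflexive (cong qPoch (ℕ.n∸n≡0 N))) ⟩
  𝟙 ⊛ qPoch (suc N) ⊛ 𝟙
    ≈⟨ solve 1 (λ E → con 1ℤ :* E :* con 1ℤ := E) ≋-refl (qPoch (suc N)) ⟩
  qPoch (suc N) ∎
  where open ≋-Reasoning
... | inj₁ j<N = begin
  (A ⊕ X ⊛ B) ⊛ (qPoch j ⊛ 𝟙-X^ suc j) ⊛ qPoch (N ∸ j)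
    ≈⟨ ⊛-congˡ (≋-reflexive (cong qPoch N∸j≡1+m)) ⟩
  (A ⊕ X ⊛ B) ⊛ (qPoch j ⊛ 𝟙-X^ suc j) ⊛ (qPoch m ⊛ 𝟙-X^ suc m)
    ≈⟨ solve 7 (λ A X B Eⱼ Lⱼ Eₘ Lₘ → (A :+ X :* B) :* (Eⱼ :* Lⱼ) :* (Eₘ :* Lₘ)
                                     := (A :* Eⱼ :* (Eₘ :* Lₘ)) :* Lⱼ :+ X :* (B :* (Eⱼ :* Lⱼ) :* Eₘ) :* Lₘ)
            ≋-refl A X B (qPoch j) (𝟙-X^ suc j) (qPoch m) (𝟙-X^ suc m) ⟩
  (A ⊛ qPoch j ⊛ (qPoch m ⊛ 𝟙-X^ suc m)) ⊛ 𝟙-X^ suc j ⊕ X ⊛ (B ⊛ (qPoch j ⊛ 𝟙-X^ suc j) ⊛ qPoch m) ⊛ 𝟙-X^ suc m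
    ≈⟨ ⊕-cong (⊛-congʳ (≋-trans (⊛-congˡ (≋-reflexive (cong qPoch (sym N∸j≡1+m)))) (qBinom-qPoch j≤N)))
              (⊛-congʳ (⊛-congˡ (qBinom-qPoch j<N))) ⟩
  qPoch N ⊛ 𝟙-X^ suc j ⊕ X ⊛ qPoch N ⊛ 𝟙-X^ suc m
    ≈⟨ solve 3 (λ E X Y → E :* (con 1ℤ :- X) :+ X :* E :* (con 1ℤ :- Y)
                       := E :* (con 1ℤ :- X :* Y))
             ≋-refl (qPoch N) X (X^ suc m) ⟩
  qPoch N ⊛ (𝟙 ⊕ ⊝ (X ⊛ X^ suc m))
    ≈⟨ ⊛-congˡ (⊕-cong (≋-refl {𝟙}) (⊝-cong (≋-trans (X^-+ (suc j) (suc m)) (≋-reflexive (cong X^_ exponents))))) ⟩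
  qPoch N ⊛ 𝟙-X^ suc N
    ∎
  where
  open ≋-Reasoning
  A = qBinom N j
  B = qBinom N (suc j)
  X = X^ suc j
  m = N ∸ suc j
  N∸j≡1+m : N ∸ j ≡ suc m
  N∸j≡1+m = ℕ.+-∸-assoc 1 j<N
  exponents : suc j + suc m ≡ suc N
  exponents = trans (ℕ.+-suc (suc j) m) (cong suc (ℕ.m+[n∸m]≡n j<N))

prev : (ℕ → Series) → ℕ → Series
prev r zero    = 𝟘
prev r (suc j) = r j

qBinom-pascal₂ : ∀ N j → qBinom (2 + N) (suc j) ≋
                 X^ (suc N ∸ j) ⊛ prev (qBinom N) j ⊕ (𝟙 ⊕ X^ suc N) ⊛ qBinom N j ⊕ X^ suc j ⊛ qBinom N (suc j)
qBinom-pascal₂ N zero = begin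
  qBinom (2 + N) 1
    ≈⟨ qBinom-pascal′ (suc N) 0 ⟩
  X^ suc N ⊛ 𝟙 ⊕ (𝟙 ⊕ X^ 1 ⊛ B)
    ≈⟨ solve 3 (λ Y X B → Y :* con 1ℤ :+ (con 1ℤ :+ X :* B)
                       := (con 1ℤ :+ Y) :* con 1ℤ :+ X :* B)
             ≋-refl (X^ suc N) (X^ 1) B ⟩
  (𝟙 ⊕ X^ suc N) ⊛ 𝟙 ⊕ X^ 1 ⊛ B
    ≈⟨ ⊕-cong (⊕-identityˡ ((𝟙 ⊕ X^ suc N) ⊛ 𝟙)) (≋-refl {X^ 1 ⊛ B}) ⟨
  𝟘 ⊕ (𝟙 ⊕ X^ suc N) ⊛ 𝟙 ⊕ X^ 1 ⊛ B
    ≈⟨ ⊕-cong (⊕-cong (⊛-zeroʳ (X^ suc N)) (≋-refl {(𝟙 ⊕ X^ suc N) ⊛ 𝟙})) (≋-refl {X^ 1 ⊛ B}) ⟨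
  X^ suc N ⊛ 𝟘 ⊕ (𝟙 ⊕ X^ suc N) ⊛ 𝟙 ⊕ X^ 1 ⊛ B
    ∎
  where
  open ≋-Reasoning
  B = qBinom N 1
qBinom-pascal₂ N (suc s) = begin
  qBinom (2 + N) (2 + s)
    ≈⟨ qBinom-pascal′ (suc N) (suc s) ⟩
  X^ (N ∸ s) ⊛ (A ⊕ X^ suc s ⊛ B) ⊕ (B ⊕ X^ (2 + s) ⊛ C)
    ≈⟨ solve 6 (λ Y A X B Z C → Y :* (A :+ X :* B) :+ (B :+ Z :* C) := Y :* A :+ B :+ (Y :* X) :* B :+ Z :* C)
             ≋-refl (X^ (N ∸ s)) A (X^ suc s) B (X^ (2 + s)) C ⟩
  X^ (N ∸ s) ⊛ A ⊕ B ⊕ (X^ (N ∸ s) ⊛ X^ suc s) ⊛ B ⊕ X^ (2 + s) ⊛ C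
    ≈⟨ ⊕-cong (⊕-cong (≋-refl {X^ (N ∸ s) ⊛ A ⊕ B}) middle) (≋-refl {X^ (2 + s) ⊛ C}) ⟩
  X^ (N ∸ s) ⊛ A ⊕ B ⊕ X^ suc N ⊛ B ⊕ X^ (2 + s) ⊛ C
    ≈⟨ solve 6 (λ Y A B W Z C → Y :* A :+ B :+ W :* B :+ Z :* C := Y :* A :+ (con 1ℤ :+ W) :* B :+ Z :* C)
             ≋-refl (X^ (N ∸ s)) A B (X^ suc N) (X^ (2 + s)) C ⟩
  X^ (N ∸ s) ⊛ A ⊕ (𝟙 ⊕ X^ suc N) ⊛ B ⊕ X^ (2 + s) ⊛ C
    ∎
  where
  open ≋-Reasoning
  A = qBinom N s
  B = qBinom N (suc s)
  C = qBinom N (2 + s)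
  middle : (X^ (N ∸ s) ⊛ X^ suc s) ⊛ B ≋ X^ suc N ⊛ B
  middle = ≋-trans (⊛-congʳ (X^-+ (N ∸ s) (suc s)))
                   (X^-⊛-qBinom N (suc s) (λ s<N → trans (ℕ.+-suc (N ∸ s) s) (cong suc (ℕ.m∸n+n≡m (ℕ.<⇒≤ s<N)))))

-- A finite form of Jacobi's identity

±𝟙 : ℕ → Series
±𝟙 zero    = 𝟙
±𝟙 (suc k) = ⊝ ±𝟙 k

triangular : ℕ → ℕ
triangular zero    = 0
triangular (suc m) = suc m + triangular m

-- T k = k (k + 1) / 2 on all of ℤ, so that T (-1 - m) = T m.
T : ℤ → ℕ
T (+ m)    = triangular m
T -[1+ m ] = triangular m

T-suc : ∀ k → + T (k ℤ.+ 1ℤ) ≡ + T k ℤ.+ (k ℤ.+ 1ℤ)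
T-suc (+ m) = begin
  + triangular (m + 1)           ≡⟨ cong (+_ ∘ triangular) (ℕ.+-comm m 1) ⟩
  + (suc m + triangular m)       ≡⟨ cong +_ (ℕ.+-comm (suc m) (triangular m)) ⟩
  + (triangular m + suc m)       ≡⟨ ℤ.pos-+ (triangular m) (suc m) ⟩
  + triangular m ℤ.+ + suc m     ≡⟨ cong (λ i → + triangular m ℤ.+ + i) (ℕ.+-comm 1 m) ⟩
  + triangular m ℤ.+ + (m + 1)   ∎
  where open ≡-Reasoning
T-suc -[1+ zero ]  = refl
T-suc -[1+ suc m ] = sym (begin
  + (suc m + triangular m) ℤ.+ -[1+ m ]         ≡⟨ cong (ℤ._+ -[1+ m ]) (ℤ.pos-+ (suc m) (triangular m)) ⟩
  + suc m ℤ.+ + triangular m ℤ.+ ℤ.- + suc m    ≡⟨ cancel (+ suc m) (+ triangular m) ⟩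
  + triangular m                                ∎)
  where
  open ≡-Reasoning
  cancel : ∀ a b → a ℤ.+ b ℤ.+ ℤ.- a ≡ b
  cancel = solve-∀

T[_-_] : ℕ → ℕ → ℕ
T[ j - n ] = T (+ j ℤ.- + n)

T-step : ∀ j n → + T[ suc j - n ] ≡ + T[ j - n ] ℤ.+ (+ j ℤ.- + n ℤ.+ 1ℤ)
T-step j n = trans (cong (+_ ∘ T) (reassociate (+ j) (+ n))) (T-suc (+ j ℤ.- + n))
  where
  reassociate : ∀ j n → 1ℤ ℤ.+ j ℤ.- n ≡ j ℤ.- n ℤ.+ 1ℤ
  reassociate = solve-∀

T-shift : ∀ j n → T[ suc j - suc n ] ≡ T[ j - n ]
T-shift j n = cong T (cancel (+ j) (+ n))
  where
  cancel : ∀ j n → 1ℤ ℤ.+ j ℤ.- (1ℤ ℤ.+ n) ≡ j ℤ.- n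
  cancel = solve-∀

pos-∸ : ∀ {m n} → n ≤ m → + (m ∸ n) ≡ + m ℤ.- + n
pos-∸ {m} {n} n≤m = sym (trans (ℤ.m-n≡m⊖n m n) (ℤ.⊖-≥ n≤m))

T-zero-suc : ∀ n → T[ 0 - suc n ] ≡ n + T[ 0 - n ]
T-zero-suc n = ℤ.+-injective (sym (begin
  + (n + T[ 0 - n ])                                       ≡⟨ ℤ.pos-+ n T[ 0 - n ] ⟩
  + n ℤ.+ + T[ 0 - n ]                                     ≡⟨ cong (λ t → + n ℤ.+ + t) (T-shift 0 n) ⟨
  + n ℤ.+ + T[ 1 - suc n ]                                 ≡⟨ cong (ℤ._+_ (+ n)) (T-step 0 (suc n)) ⟩
  + n ℤ.+ (+ T[ 0 - suc n ] ℤ.+ (0ℤ ℤ.- + suc n ℤ.+ 1ℤ))   ≡⟨ cancel (+ n) (+ T[ 0 - suc n ]) ⟩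
  + T[ 0 - suc n ]                                         ∎))
  where
  open ≡-Reasoning
  cancel : ∀ n t → n ℤ.+ (t ℤ.+ (0ℤ ℤ.- (1ℤ ℤ.+ n) ℤ.+ 1ℤ)) ≡ t
  cancel = solve-∀

T-step-ℕ : ∀ j n → T[ j - n ] + suc j ≡ T[ suc j - n ] + n
T-step-ℕ j n = ℤ.+-injective (begin
  + (T[ j - n ] + suc j)                                 ≡⟨ ℤ.pos-+ T[ j - n ] (suc j) ⟩
  + T[ j - n ] ℤ.+ (1ℤ ℤ.+ + j)                          ≡⟨ regroup (+ T[ j - n ]) (+ j) (+ n) ⟩
  + T[ j - n ] ℤ.+ (+ j ℤ.- + n ℤ.+ 1ℤ) ℤ.+ + n          ≡⟨ cong (ℤ._+ + n) (T-step j n) ⟨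
  + T[ suc j - n ] ℤ.+ + n                               ≡⟨ ℤ.pos-+ T[ suc j - n ] n ⟨
  + (T[ suc j - n ] + n)                                 ∎)
  where
  open ≡-Reasoning
  regroup : ∀ t j n → t ℤ.+ (1ℤ ℤ.+ j) ≡ t ℤ.+ (j ℤ.- n ℤ.+ 1ℤ) ℤ.+ n
  regroup = solve-∀

T-step-complement : ∀ s n → s ≤ n + n → T[ suc s - n ] + (n + n ∸ s) ≡ suc n + T[ s - n ]
T-step-complement s n s≤2n = ℤ.+-injective (begin
  + (T[ suc s - n ] + (n + n ∸ s))
    ≡⟨ ℤ.pos-+ T[ suc s - n ] (n + n ∸ s) ⟩
  + T[ suc s - n ] ℤ.+ + (n + n ∸ s)
    ≡⟨ cong₂ ℤ._+_ (T-step s n) (pos-∸ s≤2n) ⟩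
  + T[ s - n ] ℤ.+ (+ s ℤ.- + n ℤ.+ 1ℤ) ℤ.+ (+ (n + n) ℤ.- + s)
    ≡⟨ cong (λ m → + T[ s - n ] ℤ.+ (+ s ℤ.- + n ℤ.+ 1ℤ) ℤ.+ (m ℤ.- + s)) (ℤ.pos-+ n n) ⟩
  + T[ s - n ] ℤ.+ (+ s ℤ.- + n ℤ.+ 1ℤ) ℤ.+ (+ n ℤ.+ + n ℤ.- + s)
    ≡⟨ regroup (+ T[ s - n ]) (+ s) (+ n) ⟩
  1ℤ ℤ.+ + n ℤ.+ + T[ s - n ]
    ≡⟨ ℤ.pos-+ (suc n) T[ s - n ] ⟨
  + (suc n + T[ s - n ]) ∎)
  where
  open ≡-Reasoning
  regroup : ∀ t s n → t ℤ.+ (s ℤ.- n ℤ.+ 1ℤ) ℤ.+ (n ℤ.+ n ℤ.- s) ≡ 1ℤ ℤ.+ n ℤ.+ t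
  regroup = solve-∀

jacobiTerm : ℕ → ℕ → Series
jacobiTerm n j = ±𝟙 (j + n) ⊛ X^ T[ j - n ] ⊛ qBinom (n + n) j

jacobiTerm-suc-zero : ∀ n → jacobiTerm (suc n) 0 ≋ ⊝ X^ n ⊛ jacobiTerm n 0
jacobiTerm-suc-zero n = begin
  ⊝ ±𝟙 n ⊛ X^ T[ 0 - suc n ] ⊛ 𝟙
    ≈⟨ ⊛-congʳ (⊛-congˡ (≋-trans (≋-reflexive (cong X^_ (T-zero-suc n))) (≋-sym (X^-+ n T[ 0 - n ])))) ⟩
  ⊝ ±𝟙 n ⊛ (X^ n ⊛ X^ T[ 0 - n ]) ⊛ 𝟙
    ≈⟨ solve 3 (λ S X E → :- S :* (X :* E) :* con 1ℤ
                       := :- X :* (S :* E :* con 1ℤ))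
             ≋-refl (±𝟙 n) (X^ n) (X^ T[ 0 - n ]) ⟩
  ⊝ X^ n ⊛ (±𝟙 n ⊛ X^ T[ 0 - n ] ⊛ 𝟙) ∎
  where open ≋-Reasoning

jacobiTerm-from-prev : ∀ n j → ±𝟙 (j + n) ⊛ (X^ T[ j - n ] ⊛ X^ (suc (n + n) ∸ j)) ⊛ prev (qBinom (n + n)) j
                     ≋ ⊝ X^ suc n ⊛ prev (jacobiTerm n) j
jacobiTerm-from-prev n zero    = ≋-trans (⊛-zeroʳ _) (≋-sym (⊛-zeroʳ _))
jacobiTerm-from-prev n (suc s) = begin
  ⊝ S ⊛ (X^ T[ suc s - n ] ⊛ X^ (n + n ∸ s)) ⊛ B
    ≈⟨ ⊛-assoc (⊝ S) _ B ⟩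
  ⊝ S ⊛ ((X^ T[ suc s - n ] ⊛ X^ (n + n ∸ s)) ⊛ B)
    ≈⟨ ⊛-congˡ (⊛-congʳ (X^-+ T[ suc s - n ] (n + n ∸ s))) ⟩
  ⊝ S ⊛ (X^ (T[ suc s - n ] + (n + n ∸ s)) ⊛ B)
    ≈⟨ ⊛-congˡ (X^-⊛-qBinom (n + n) s (T-step-complement s n)) ⟩
  ⊝ S ⊛ (X^ (suc n + T[ s - n ]) ⊛ B)
    ≈⟨ ⊛-congˡ (⊛-congʳ (X^-+ (suc n) T[ s - n ])) ⟨
  ⊝ S ⊛ ((X^ suc n ⊛ X^ T[ s - n ]) ⊛ B)
    ≈⟨ solve 4 (λ S X E B → :- S :* ((X :* E) :* B)
                         := :- X :* (S :* E :* B))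
             ≋-refl S (X^ suc n) (X^ T[ s - n ]) B ⟩
  ⊝ X^ suc n ⊛ (S ⊛ X^ T[ s - n ] ⊛ B) ∎
  where
  open ≋-Reasoning
  S = ±𝟙 (s + n)
  B = qBinom (n + n) s

jacobiTerm-from-next : ∀ n j → ±𝟙 (j + n) ⊛ (X^ T[ j - n ] ⊛ X^ suc j) ⊛ qBinom (n + n) (suc j)
                     ≋ ⊝ X^ n ⊛ jacobiTerm n (suc j)
jacobiTerm-from-next n j = begin
  S ⊛ (X^ T[ j - n ] ⊛ X^ suc j) ⊛ B
    ≈⟨ ⊛-congʳ (⊛-congˡ exponents) ⟩
  S ⊛ (X^ T[ suc j - n ] ⊛ X^ n) ⊛ B
    ≈⟨ solve 4 (λ S F X B → S :* (F :* X) :* B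
                         := :- X :* (:- S :* F :* B))
             ≋-refl S (X^ T[ suc j - n ]) (X^ n) B ⟩
  ⊝ X^ n ⊛ (⊝ S ⊛ X^ T[ suc j - n ] ⊛ B) ∎
  where
  open ≋-Reasoning
  S = ±𝟙 (j + n)
  B = qBinom (n + n) (suc j)
  exponents : X^ T[ j - n ] ⊛ X^ suc j ≋ X^ T[ suc j - n ] ⊛ X^ n
  exponents = ≋-trans (X^-+ T[ j - n ] (suc j))
                      (≋-trans (≋-reflexive (cong X^_ (T-step-ℕ j n))) (≋-sym (X^-+ T[ suc j - n ] n)))

jacobiTerm-suc : ∀ n j → jacobiTerm (suc n) (suc j) ≋
  (𝟙 ⊕ X^ suc (n + n)) ⊛ jacobiTerm n j ⊕ ⊝ X^ suc n ⊛ prev (jacobiTerm n) j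
  ⊕ ⊝ X^ n ⊛ jacobiTerm n (suc j)
jacobiTerm-suc n j = begin
  ±𝟙 (suc j + suc n) ⊛ X^ T[ suc j - suc n ] ⊛ qBinom (suc n + suc n) (suc j)
    ≈⟨ ⊛-cong (⊛-cong sign (≋-reflexive (cong X^_ (T-shift j n)))) binomial ⟩
  ⊝ ⊝ S ⊛ E ⊛ (X^ (suc (n + n) ∸ j) ⊛ prev B j ⊕ A ⊛ B j ⊕ X^ suc j ⊛ B (suc j))
    ≈⟨ solve 8 (λ S E Y Bₚ A Bⱼ X B₊ → :- (:- S) :* E :* (Y :* Bₚ :+ A :* Bⱼ :+ X :* B₊)
                                      := A :* (S :* E :* Bⱼ) :+ S :* (E :* Y) :* Bₚ :+ S :* (E :* X) :* B₊)
             ≋-refl S E (X^ (suc (n + n) ∸ j)) (prev B j) A (B j) (X^ suc j) (B (suc j)) ⟩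
  A ⊛ (S ⊛ E ⊛ B j) ⊕ S ⊛ (E ⊛ X^ (suc (n + n) ∸ j)) ⊛ prev B j ⊕ S ⊛ (E ⊛ X^ suc j) ⊛ B (suc j)
    ≈⟨ ⊕-cong (⊕-cong (≋-refl {A ⊛ jacobiTerm n j}) (jacobiTerm-from-prev n j)) (jacobiTerm-from-next n j) ⟩
  A ⊛ jacobiTerm n j ⊕ ⊝ X^ suc n ⊛ prev (jacobiTerm n) j ⊕ ⊝ X^ n ⊛ jacobiTerm n (suc j)
    ∎
  where
  open ≋-Reasoning
  S = ±𝟙 (j + n)
  E = X^ T[ j - n ]
  A = 𝟙 ⊕ X^ suc (n + n)
  B = qBinom (n + n)
  sign : ±𝟙 (suc j + suc n) ≋ ⊝ ⊝ S
  sign = ⊝-cong (≋-reflexive (cong ±𝟙 (ℕ.+-suc j n)))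
  binomial : qBinom (suc n + suc n) (suc j) ≋ X^ (suc (n + n) ∸ j) ⊛ prev B j ⊕ A ⊛ B j ⊕ X^ suc j ⊛ B (suc j)
  binomial = ≋-trans (≋-reflexive (cong (λ N → qBinom N (suc j)) (cong suc (ℕ.+-suc n n))))
                     (qBinom-pascal₂ (n + n) j)

∙-as-const : ∀ c f → c ∙ f ≋ const c ⊛ f
∙-as-const c f = ≋-sym (const-⊛ c f)

wsum : ℕ → (ℕ → ℤ) → (ℕ → Series) → Series
wsum zero    w r = 𝟘
wsum (suc L) w r = w 0 ∙ r 0 ⊕ wsum L (w ∘ suc) (r ∘ suc)

wsum-cong-weights : ∀ L {w w′} r → (∀ j → w j ≡ w′ j) → wsum L w r ≋ wsum L w′ r
wsum-cong-weights zero    r w≡w′ = ≋-refl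
wsum-cong-weights (suc L) r w≡w′ =
  ⊕-cong (≋-reflexive (cong (_∙ r 0) (w≡w′ 0))) (wsum-cong-weights L (r ∘ suc) (w≡w′ ∘ suc))

wsum-cong-terms : ∀ L w {r r′} → (∀ j → r j ≋ r′ j) → wsum L w r ≋ wsum L w r′
wsum-cong-terms zero    w r≋r′ = ≋-refl
wsum-cong-terms (suc L) w r≋r′ = ⊕-cong (∙-congˡ (w 0) (r≋r′ 0)) (wsum-cong-terms L (w ∘ suc) (r≋r′ ∘ suc))

wsum-⊕ : ∀ L w r r′ → wsum L w (λ j → r j ⊕ r′ j) ≋ wsum L w r ⊕ wsum L w r′
wsum-⊕ L w r r′ = mk≋ (go L w r r′)
  where
  go : ∀ L w r r′ n → wsum L w (λ j → r j ⊕ r′ j) n ≡ (wsum L w r ⊕ wsum L w r′) n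
  go zero    w r r′ n = refl
  go (suc L) w r r′ n = trans (cong (ℤ._+_ (w 0 ℤ.* (r 0 n ℤ.+ r′ 0 n))) (go L (w ∘ suc) (r ∘ suc) (r′ ∘ suc) n))
                              (regroup (w 0) (r 0 n) (r′ 0 n) _ _)
    where
    regroup : ∀ w a b c d → w ℤ.* (a ℤ.+ b) ℤ.+ (c ℤ.+ d) ≡ w ℤ.* a ℤ.+ c ℤ.+ (w ℤ.* b ℤ.+ d)
    regroup = solve-∀

wsum-linear : ∀ L a b w r → wsum L (λ j → a ℤ.* w j ℤ.+ b) r ≋ a ∙ wsum L w r ⊕ b ∙ wsum L (λ _ → 1ℤ) r
wsum-linear L a b w r = mk≋ (go L w r)
  where
  go : ∀ L w r n → wsum L (λ j → a ℤ.* w j ℤ.+ b) r n ≡ a ℤ.* wsum L w r n ℤ.+ b ℤ.* wsum L (λ _ → 1ℤ) r n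
  go zero    w r n = sym (trans (cong₂ ℤ._+_ (ℤ.*-zeroʳ a) (ℤ.*-zeroʳ b)) refl)
  go (suc L) w r n = trans (cong (ℤ._+_ ((a ℤ.* w 0 ℤ.+ b) ℤ.* r 0 n)) (go L (w ∘ suc) (r ∘ suc) n))
                           (regroup a b (w 0) (r 0 n) _ _)
    where
    regroup : ∀ a b w x y z → (a ℤ.* w ℤ.+ b) ℤ.* x ℤ.+ (a ℤ.* y ℤ.+ b ℤ.* z)
                            ≡ a ℤ.* (w ℤ.* x ℤ.+ y) ℤ.+ b ℤ.* (1ℤ ℤ.* x ℤ.+ z)
    regroup = solve-∀

wsum-⊛ : ∀ L w f r → wsum L w (λ j → f ⊛ r j) ≋ f ⊛ wsum L w r
wsum-⊛ zero    w f r = ≋-sym (⊛-zeroʳ f)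
wsum-⊛ (suc L) w f r = begin
  w 0 ∙ (f ⊛ r 0) ⊕ wsum L (w ∘ suc) (λ j → f ⊛ r (suc j))
    ≈⟨ ⊕-cong (∙-as-const (w 0) (f ⊛ r 0)) (wsum-⊛ L (w ∘ suc) f (r ∘ suc)) ⟩
  const (w 0) ⊛ (f ⊛ r 0) ⊕ f ⊛ wsum L (w ∘ suc) (r ∘ suc)
    ≈⟨ solve 4 (λ c f r s → c :* (f :* r) :+ f :* s := f :* (c :* r :+ s)) ≋-refl (const (w 0)) f (r 0) _ ⟩
  f ⊛ (const (w 0) ⊛ r 0 ⊕ wsum L (w ∘ suc) (r ∘ suc))
    ≈⟨ ⊛-congˡ (⊕-cong (∙-as-const (w 0) (r 0)) ≋-refl) ⟨
  f ⊛ wsum (suc L) w r ∎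
  where open ≋-Reasoning

wsum-extend : ∀ L d w r → (∀ j → L ≤ j → r j ≋ 𝟘) → wsum (L + d) w r ≋ wsum L w r
wsum-extend zero    d w r vanish = all-zero d w r (λ j → vanish j z≤n)
  where
  all-zero : ∀ d w r → (∀ j → r j ≋ 𝟘) → wsum d w r ≋ 𝟘
  all-zero zero    w r r≋𝟘 = ≋-refl
  all-zero (suc d) w r r≋𝟘 = ≋-trans (⊕-cong (∙-congˡ (w 0) (r≋𝟘 0)) (all-zero d (w ∘ suc) (r ∘ suc) (r≋𝟘 ∘ suc)))
                                     (mk≋ (λ n → trans (ℤ.+-identityʳ _) (ℤ.*-zeroʳ (w 0))))
wsum-extend (suc L) d w r vanish =
  ⊕-cong (≋-refl {w 0 ∙ r 0}) (wsum-extend L d (w ∘ suc) (r ∘ suc) (λ j L≤j → vanish (suc j) (s≤s L≤j)))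

wsum-modX^ : ∀ L w {K r r′} → (∀ j → j < L → r j ≋ r′ j modX^ K) → wsum L w r ≋ wsum L w r′ modX^ K
wsum-modX^ zero    w r≈r′ = modX^-refl
wsum-modX^ (suc L) w r≈r′ =
  modX^-⊕ (modX^-∙ (w 0) (r≈r′ 0 (s≤s z≤n))) (wsum-modX^ L (w ∘ suc) (λ j j<L → r≈r′ (suc j) (s≤s j<L)))

jacobiSum : ℕ → (ℕ → ℤ) → Series
jacobiSum n w = wsum (suc (n + n)) w (jacobiTerm n)

jacobiTerm-above : ∀ n j → suc (n + n) ≤ j → jacobiTerm n j ≋ 𝟘
jacobiTerm-above n j 2n<j = ≋-trans (⊛-congˡ (qBinom-above 2n<j)) (⊛-zeroʳ _)

jacobiSum-suc : ∀ n w → jacobiSum (suc n) w ≋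
  (𝟙 ⊕ X^ suc (n + n)) ⊛ jacobiSum n (w ∘ suc) ⊕ ⊝ X^ suc n ⊛ jacobiSum n (w ∘ suc ∘ suc)
  ⊕ ⊝ X^ n ⊛ jacobiSum n w
jacobiSum-suc n w = begin
  jacobiSum (suc n) w
    ≈⟨ ≋-reflexive (cong (λ L → wsum L w (jacobiTerm (suc n))) (cong (suc ∘ suc) (ℕ.+-suc n n))) ⟩
  w 0 ∙ jacobiTerm (suc n) 0 ⊕ W (jacobiTerm (suc n) ∘ suc)
    ≈⟨ ⊕-cong (∙-congˡ (w 0) (jacobiTerm-suc-zero n)) (wsum-cong-terms (suc L) (w ∘ suc) (jacobiTerm-suc n)) ⟩
  w 0 ∙ (γ ⊛ c 0) ⊕ W (λ j → α ⊛ c j ⊕ β ⊛ prev c j ⊕ γ ⊛ c (suc j))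
    ≈⟨ ⊕-cong (∙-as-const (w 0) (γ ⊛ c 0)) split ⟩
  const (w 0) ⊛ (γ ⊛ c 0) ⊕ (α ⊛ W c ⊕ β ⊛ W (prev c) ⊕ γ ⊛ W (c ∘ suc))
    ≈⟨ solve 8 (λ w γ c₀ α A β B C → w :* (γ :* c₀) :+ (α :* A :+ β :* B :+ γ :* C)
                                  := α :* A :+ β :* B :+ γ :* (w :* c₀ :+ C))
             ≋-refl (const (w 0)) γ (c 0) α (W c) β (W (prev c)) (W (c ∘ suc)) ⟩
  α ⊛ W c ⊕ β ⊛ W (prev c) ⊕ γ ⊛ (const (w 0) ⊛ c 0 ⊕ W (c ∘ suc))
    ≈⟨ ⊕-cong (⊕-cong (⊛-congˡ (extend 1 {w ∘ suc})) (⊛-congˡ prev-sum))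
              (⊛-congˡ (≋-trans (⊕-cong (≋-sym (∙-as-const (w 0) (c 0))) ≋-refl) (extend 2 {w}))) ⟩
  α ⊛ jacobiSum n (w ∘ suc) ⊕ β ⊛ jacobiSum n (w ∘ suc ∘ suc) ⊕ γ ⊛ jacobiSum n w ∎
  where
  open ≋-Reasoning
  L = suc (n + n)
  c = jacobiTerm n
  α = 𝟙 ⊕ X^ suc (n + n)
  β = ⊝ X^ suc n
  γ = ⊝ X^ n
  W : (ℕ → Series) → Series
  W = wsum (suc L) (w ∘ suc)
  split : W (λ j → α ⊛ c j ⊕ β ⊛ prev c j ⊕ γ ⊛ c (suc j)) ≋ α ⊛ W c ⊕ β ⊛ W (prev c) ⊕ γ ⊛ W (c ∘ suc)
  split = begin
    W (λ j → α ⊛ c j ⊕ β ⊛ prev c j ⊕ γ ⊛ c (suc j))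
      ≈⟨ wsum-⊕ (suc L) (w ∘ suc) (λ j → α ⊛ c j ⊕ β ⊛ prev c j) (λ j → γ ⊛ c (suc j)) ⟩
    W (λ j → α ⊛ c j ⊕ β ⊛ prev c j) ⊕ W (λ j → γ ⊛ c (suc j))
      ≈⟨ ⊕-cong (wsum-⊕ (suc L) (w ∘ suc) (λ j → α ⊛ c j) (λ j → β ⊛ prev c j)) ≋-refl ⟩
    W (λ j → α ⊛ c j) ⊕ W (λ j → β ⊛ prev c j) ⊕ W (λ j → γ ⊛ c (suc j))
      ≈⟨ ⊕-cong (⊕-cong (wsum-⊛ (suc L) (w ∘ suc) α c) (wsum-⊛ (suc L) (w ∘ suc) β (prev c)))
                (wsum-⊛ (suc L) (w ∘ suc) γ (c ∘ suc)) ⟩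
    α ⊛ W c ⊕ β ⊛ W (prev c) ⊕ γ ⊛ W (c ∘ suc) ∎
  extend : ∀ d {w} → wsum (d + L) w c ≋ wsum L w c
  extend d {w} = ≋-trans (≋-reflexive (cong (λ l → wsum l w c) (ℕ.+-comm d L)))
                         (wsum-extend L d w c (jacobiTerm-above n))
  prev-sum : W (prev c) ≋ wsum L (w ∘ suc ∘ suc) c
  prev-sum = ≋-trans (⊕-cong (mk≋ (λ _ → ℤ.*-zeroʳ (w 1))) ≋-refl) (⊕-identityˡ _)

jacobi-coefficients-sum : ∀ n → (𝟙 ⊕ X^ suc (n + n)) ⊕ ⊝ X^ suc n ⊕ ⊝ X^ n ≋ 𝟙-X^ n ⊛ 𝟙-X^ suc n
jacobi-coefficients-sum n = begin
  (𝟙 ⊕ X^ suc (n + n)) ⊕ ⊝ X^ suc n ⊕ ⊝ X^ n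
    ≈⟨ ⊕-cong (⊕-cong (⊕-cong (≋-refl {𝟙}) product) ≋-refl) ≋-refl ⟨
  (𝟙 ⊕ X^ n ⊛ X^ suc n) ⊕ ⊝ X^ suc n ⊕ ⊝ X^ n
    ≈⟨ solve 2 (λ X Y → con 1ℤ :+ X :* Y :- Y :- X
                     := (con 1ℤ :- X) :* (con 1ℤ :- Y))
             ≋-refl (X^ n) (X^ suc n) ⟩
  𝟙-X^ n ⊛ 𝟙-X^ suc n ∎
  where
  open ≋-Reasoning
  product : X^ n ⊛ X^ suc n ≋ X^ suc (n + n)
  product = ≋-trans (X^-+ n (suc n)) (≋-reflexive (cong X^_ (ℕ.+-suc n n)))

jacobiSum-one : ∀ n → jacobiSum (suc n) (λ _ → 1ℤ) ≋ 𝟙-X^ n ⊛ 𝟙-X^ suc n ⊛ jacobiSum n (λ _ → 1ℤ)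
jacobiSum-one n = begin
  jacobiSum (suc n) (λ _ → 1ℤ)
    ≈⟨ jacobiSum-suc n (λ _ → 1ℤ) ⟩
  α ⊛ A ⊕ β ⊛ A ⊕ γ ⊛ A
    ≈⟨ solve 4 (λ α β γ A → α :* A :+ β :* A :+ γ :* A := (α :+ β :+ γ) :* A) ≋-refl α β γ A ⟩
  (α ⊕ β ⊕ γ) ⊛ A
    ≈⟨ ⊛-congʳ (jacobi-coefficients-sum n) ⟩
  𝟙-X^ n ⊛ 𝟙-X^ suc n ⊛ A ∎
  where
  open ≋-Reasoning
  α = 𝟙 ⊕ X^ suc (n + n)
  β = ⊝ X^ suc n
  γ = ⊝ X^ n
  A = jacobiSum n (λ _ → 1ℤ)

jacobiSum-one-vanishes : ∀ n → jacobiSum (suc n) (λ _ → 1ℤ) ≋ 𝟘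
jacobiSum-one-vanishes zero = begin
  jacobiSum 1 (λ _ → 1ℤ)                            ≈⟨ jacobiSum-one 0 ⟩
  𝟙-X^ 0 ⊛ 𝟙-X^ 1 ⊛ jacobiSum 0 (λ _ → 1ℤ)          ≈⟨ ⊛-congʳ (⊛-congʳ (mk≋ (λ n → ℤ.+-inverseʳ (𝟙 n)))) ⟩
  𝟘 ⊛ 𝟙-X^ 1 ⊛ jacobiSum 0 (λ _ → 1ℤ)               ≈⟨ ≋-trans (⊛-congʳ (⊛-zeroˡ (𝟙-X^ 1))) (⊛-zeroˡ _) ⟩
  𝟘                                                 ∎
  where open ≋-Reasoning
jacobiSum-one-vanishes (suc n) = begin
  jacobiSum (2 + n) (λ _ → 1ℤ)                                ≈⟨ jacobiSum-one (suc n) ⟩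
  𝟙-X^ suc n ⊛ 𝟙-X^ (2 + n) ⊛ jacobiSum (suc n) (λ _ → 1ℤ)    ≈⟨ ⊛-congˡ (jacobiSum-one-vanishes n) ⟩
  𝟙-X^ suc n ⊛ 𝟙-X^ (2 + n) ⊛ 𝟘                               ≈⟨ ⊛-zeroʳ _ ⟩
  𝟘                                                           ∎
  where open ≋-Reasoning

jacobiSum-centred : ∀ n → jacobiSum (suc n) (λ j → + j ℤ.- + suc n) ≋
  𝟙-X^ n ⊛ 𝟙-X^ suc n ⊛ jacobiSum n (λ j → + j ℤ.- + n) ⊕ (X^ n ⊕ ⊝ X^ suc n) ⊛ jacobiSum n (λ _ → 1ℤ)
jacobiSum-centred n = begin
  jacobiSum (suc n) w′
    ≈⟨ jacobiSum-suc n w′ ⟩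
  α ⊛ jacobiSum n (w′ ∘ suc) ⊕ β ⊛ jacobiSum n (w′ ∘ suc ∘ suc) ⊕ γ ⊛ jacobiSum n w′
    ≈⟨ ⊕-cong (⊕-cong (⊛-congˡ reweight₁) (⊛-congˡ reweight₂)) (⊛-congˡ reweight₀) ⟩
  α ⊛ D ⊕ β ⊛ (1ℤ ∙ D ⊕ 1ℤ ∙ A) ⊕ γ ⊛ (1ℤ ∙ D ⊕ (ℤ.- 1ℤ) ∙ A)
    ≈⟨ ⊕-cong (⊕-cong (≋-refl {α ⊛ D}) (⊛-congˡ (⊕-cong (∙-as-const 1ℤ D) (∙-as-const 1ℤ A))))
              (⊛-congˡ (⊕-cong (∙-as-const 1ℤ D) (∙-as-const (ℤ.- 1ℤ) A))) ⟩
  α ⊛ D ⊕ β ⊛ (𝟙 ⊛ D ⊕ 𝟙 ⊛ A) ⊕ γ ⊛ (𝟙 ⊛ D ⊕ const (ℤ.- 1ℤ) ⊛ A)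
    ≈⟨ solve 5 (λ α β γ D A → α :* D :+ β :* (con 1ℤ :* D :+ con 1ℤ :* A)
                                 :+ γ :* (con 1ℤ :* D :+ con (ℤ.- 1ℤ) :* A)
                           := (α :+ β :+ γ) :* D :+ (β :- γ) :* A)
             ≋-refl α β γ D A ⟩
  (α ⊕ β ⊕ γ) ⊛ D ⊕ (β ⊕ ⊝ γ) ⊛ A
    ≈⟨ ⊕-cong (⊛-congʳ (jacobi-coefficients-sum n))
              (⊛-congʳ (solve 2 (λ X Y → :- Y :- :- X := X :- Y) ≋-refl (X^ n) (X^ suc n))) ⟩
  𝟙-X^ n ⊛ 𝟙-X^ suc n ⊛ D ⊕ (X^ n ⊕ ⊝ X^ suc n) ⊛ A ∎
  where
  open ≋-Reasoning
  L = suc (n + n)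
  c = jacobiTerm n
  w w′ : ℕ → ℤ
  w  j = + j ℤ.- + n
  w′ j = + j ℤ.- + suc n
  α = 𝟙 ⊕ X^ suc (n + n)
  β = ⊝ X^ suc n
  γ = ⊝ X^ n
  A = jacobiSum n (λ _ → 1ℤ)
  D = jacobiSum n w
  reweight₁ : jacobiSum n (w′ ∘ suc) ≋ D
  reweight₁ = wsum-cong-weights L c (λ j → shift (+ j) (+ n))
    where
    shift : ∀ j n → 1ℤ ℤ.+ j ℤ.- (1ℤ ℤ.+ n) ≡ j ℤ.- n
    shift = solve-∀
  reweight₂ : jacobiSum n (w′ ∘ suc ∘ suc) ≋ 1ℤ ∙ D ⊕ 1ℤ ∙ A
  reweight₂ = ≋-trans (wsum-cong-weights L c (λ j → shift (+ j) (+ n))) (wsum-linear L 1ℤ 1ℤ w c)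
    where
    shift : ∀ j n → 1ℤ ℤ.+ (1ℤ ℤ.+ j) ℤ.- (1ℤ ℤ.+ n) ≡ 1ℤ ℤ.* (j ℤ.- n) ℤ.+ 1ℤ
    shift = solve-∀
  reweight₀ : jacobiSum n w′ ≋ 1ℤ ∙ D ⊕ (ℤ.- 1ℤ) ∙ A
  reweight₀ = ≋-trans (wsum-cong-weights L c (λ j → shift (+ j) (+ n))) (wsum-linear L 1ℤ (ℤ.- 1ℤ) w c)
    where
    shift : ∀ j n → j ℤ.- (1ℤ ℤ.+ n) ≡ 1ℤ ℤ.* (j ℤ.- n) ℤ.+ ℤ.- 1ℤ
    shift = solve-∀

jacobiSum-zero : ∀ w → jacobiSum 0 w ≋ const (w 0)
jacobiSum-zero w = ≋-trans (⊕-identityʳ _) (≋-trans (∙-as-const (w 0) _)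
                     (solve 1 (λ c → c :* (con 1ℤ :* con 1ℤ :* con 1ℤ) := c) ≋-refl (const (w 0))))

jacobiSum-centred-value : ∀ n → jacobiSum (suc n) (λ j → + j ℤ.- + suc n) ≋ qPoch (suc n) ⊛ qPoch n
jacobiSum-centred-value zero = begin
  jacobiSum 1 (λ j → + j ℤ.- 1ℤ)
    ≈⟨ jacobiSum-centred 0 ⟩
  𝟙-X^ 0 ⊛ 𝟙-X^ 1 ⊛ jacobiSum 0 (λ j → + j ℤ.- 0ℤ) ⊕ (X^ 0 ⊕ ⊝ X^ 1) ⊛ jacobiSum 0 (λ _ → 1ℤ)
    ≈⟨ ⊕-cong (⊛-congˡ (jacobiSum-zero (λ j → + j ℤ.- 0ℤ))) (⊛-congˡ (jacobiSum-zero (λ _ → 1ℤ))) ⟩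
  𝟙-X^ 0 ⊛ 𝟙-X^ 1 ⊛ const 0ℤ ⊕ (𝟙 ⊕ ⊝ X^ 1) ⊛ const 1ℤ
    ≈⟨ solve 2 (λ L₀ X → L₀ :* (con 1ℤ :- X) :* con 0ℤ :+ (con 1ℤ :- X) :* con 1ℤ
                      := con 1ℤ :* (con 1ℤ :- X) :* con 1ℤ)
             ≋-refl (𝟙-X^ 0) (X^ 1) ⟩
  qPoch 1 ⊛ qPoch 0
    ∎
  where open ≋-Reasoning
jacobiSum-centred-value (suc n) = begin
  jacobiSum (2 + n) (λ j → + j ℤ.- + (2 + n))
    ≈⟨ jacobiSum-centred (suc n) ⟩
  𝟙-X^ suc n ⊛ 𝟙-X^ (2 + n) ⊛ jacobiSum (suc n) (λ j → + j ℤ.- + suc n)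
    ⊕ (X^ suc n ⊕ ⊝ X^ (2 + n)) ⊛ jacobiSum (suc n) (λ _ → 1ℤ)
    ≈⟨ ⊕-cong (⊛-congˡ (jacobiSum-centred-value n)) (⊛-congˡ (jacobiSum-one-vanishes n)) ⟩
  𝟙-X^ suc n ⊛ 𝟙-X^ (2 + n) ⊛ (qPoch (suc n) ⊛ qPoch n) ⊕ (X^ suc n ⊕ ⊝ X^ (2 + n)) ⊛ 𝟘
    ≈⟨ ≋-trans (⊕-cong (≋-refl {𝟙-X^ suc n ⊛ 𝟙-X^ (2 + n) ⊛ (qPoch (suc n) ⊛ qPoch n)}) (⊛-zeroʳ _))
               (⊕-identityʳ _) ⟩
  𝟙-X^ suc n ⊛ 𝟙-X^ (2 + n) ⊛ (qPoch (suc n) ⊛ qPoch n)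
    ≈⟨ solve 4 (λ L₁ L₂ E₁ E₀ → L₁ :* L₂ :* (E₁ :* E₀)
                             := E₁ :* L₂ :* (E₀ :* L₁))
             ≋-refl (𝟙-X^ suc n) (𝟙-X^ (2 + n)) (qPoch (suc n)) (qPoch n) ⟩
  qPoch (2 + n) ⊛ qPoch (suc n)
    ∎
  where open ≋-Reasoning

jacobiWeight : ℕ → ℕ → ℤ
jacobiWeight n j = + 2 ℤ.* (+ j ℤ.- + n) ℤ.+ 1ℤ

jacobiSum-jacobiWeight : ∀ n → jacobiSum (suc n) (jacobiWeight (suc n)) ≋ (+ 2) ∙ (qPoch (suc n) ⊛ qPoch n)
jacobiSum-jacobiWeight n = begin
  jacobiSum (suc n) (jacobiWeight (suc n))
    ≈⟨ wsum-linear (suc (suc n + suc n)) (+ 2) 1ℤ (λ j → + j ℤ.- + suc n) (jacobiTerm (suc n)) ⟩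
  (+ 2) ∙ jacobiSum (suc n) (λ j → + j ℤ.- + suc n) ⊕ 1ℤ ∙ jacobiSum (suc n) (λ _ → 1ℤ)
    ≈⟨ ⊕-cong (∙-congˡ (+ 2) (jacobiSum-centred-value n)) (∙-congˡ 1ℤ (jacobiSum-one-vanishes n)) ⟩
  (+ 2) ∙ (qPoch (suc n) ⊛ qPoch n) ⊕ 1ℤ ∙ 𝟘
    ≈⟨ mk≋ (λ i → ℤ.+-identityʳ _) ⟩
  (+ 2) ∙ (qPoch (suc n) ⊛ qPoch n)
    ∎
  where open ≋-Reasoning

𝟙-X^-modX^ : ∀ a → 𝟙-X^ a ≋ 𝟙 modX^ a
𝟙-X^-modX^ a i i<a = trans (cong (λ x → 𝟙 i ℤ.- x) (X^-coeff-≢ a (ℕ.<⇒≢ i<a))) (ℤ.+-identityʳ (𝟙 i))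

qPoch-stable : ∀ {a M} → a ≤ M → qPoch a ≋ qPoch M modX^ suc a
qPoch-stable = go ∘ ℕ.≤⇒≤′
  where
  go : ∀ {a M} → a ℕ.≤′ M → qPoch a ≋ qPoch M modX^ suc a
  go ℕ.≤′-refl                 = modX^-refl
  go (ℕ.≤′-step {M} a≤′M) = modX^-trans (go a≤′M) (modX^-mono (s≤s (ℕ.≤′⇒≤ a≤′M)) (modX^-sym step))
    where
    step : qPoch M ⊛ 𝟙-X^ suc M ≋ qPoch M modX^ suc M
    step = modX^-respects-≋ ≋-refl (≋-trans (⊛-comm (qPoch M) 𝟙) (⊛-identityˡ (qPoch M)))
                            (modX^-⊛ (modX^-refl {f = qPoch M}) (𝟙-X^-modX^ (suc M)))

qBinom-⊛-qPoch : ∀ {N j M m} → j ≤ N → N ≤ M → m ≤ j → m ≤ N ∸ j → qBinom N j ⊛ qPoch M ≋ 𝟙 modX^ suc m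
qBinom-⊛-qPoch {N} {j} {M} {m} j≤N N≤M m≤j m≤N-j =
  modX^-respects-≋ (cancel-P≤ (B ⊛ qPoch M)) (qPoch-⊛-P≤ M) (modX^-⊛ B⊛E⊛E≈E (modX^-refl {f = P≤ M}))
  where
  B = qBinom N j
  B⊛E⊛E≈E : B ⊛ qPoch M ⊛ qPoch M ≋ qPoch M modX^ suc m
  B⊛E⊛E≈E = modX^-trans
    (modX^-⊛ (modX^-⊛ (modX^-refl {f = B}) (modX^-mono (s≤s m≤j) (modX^-sym (qPoch-stable (ℕ.≤-trans j≤N N≤M)))))
             (modX^-mono (s≤s m≤N-j) (modX^-sym (qPoch-stable (ℕ.≤-trans (ℕ.m∸n≤m N j) N≤M)))))
    (modX^-trans (≋⇒≋modX^ (qBinom-qPoch j≤N)) (modX^-mono (s≤s (ℕ.≤-trans m≤j j≤N)) (qPoch-stable N≤M)))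
  cancel-P≤ : ∀ f → f ⊛ qPoch M ⊛ P≤ M ≋ f
  cancel-P≤ f = ≋-trans (⊛-assoc f (qPoch M) (P≤ M)) (≋-trans (⊛-congˡ (qPoch-⊛-P≤ M)) (⊛-identityʳ f))

triangular-≥ : ∀ m → m ≤ triangular m
triangular-≥ zero    = z≤n
triangular-≥ (suc m) = ℕ.m≤m+n (suc m) (triangular m)

T[-]-above : ∀ {j n} → n ≤ j → T[ j - n ] ≡ triangular (j ∸ n)
T[-]-above {j} {n} n≤j = cong T (trans (ℤ.m-n≡m⊖n j n) (ℤ.⊖-≥ n≤j))

T[-]-below : ∀ {j n} → j < n → T[ j - n ] ≡ triangular (n ∸ suc j)
T[-]-below {j} {n} j<n = cong T (trans (ℤ.m-n≡m⊖n j n) (trans (ℤ.⊖-< j<n) (cong (ℤ.-_ ∘ +_) (ℕ.+-∸-assoc 1 j<n))))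

T-bound-left : ∀ j n → n ≤ T[ j - n ] + suc j
T-bound-left j n with n ℕ.≤? j
... | yes n≤j = ℕ.≤-trans (ℕ.m≤n⇒m≤1+n n≤j) (ℕ.m≤n+m (suc j) T[ j - n ])
... | no  n≰j = begin
  n                                ≡⟨ ℕ.m∸n+n≡m j<n ⟨
  n ∸ suc j + suc j                ≤⟨ ℕ.+-monoˡ-≤ (suc j) (triangular-≥ (n ∸ suc j)) ⟩
  triangular (n ∸ suc j) + suc j   ≡⟨ cong (_+ suc j) (T[-]-below j<n) ⟨
  T[ j - n ] + suc j               ∎
  where
  open ℕ.≤-Reasoning
  j<n = ℕ.≰⇒> n≰j

T-bound-right : ∀ j n → j ≤ n + n → n ≤ T[ j - n ] + suc (n + n ∸ j)
T-bound-right j n j≤2n with n ℕ.≤? j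
... | yes n≤j = begin
  n                                        ≡⟨ ℕ.+-cancelʳ-≡ n n (j ∸ n + (n + n ∸ j)) split ⟩
  j ∸ n + (n + n ∸ j)                      ≤⟨ ℕ.+-monoˡ-≤ (n + n ∸ j) (triangular-≥ (j ∸ n)) ⟩
  triangular (j ∸ n) + (n + n ∸ j)         ≡⟨ cong (_+ (n + n ∸ j)) (T[-]-above n≤j) ⟨
  T[ j - n ] + (n + n ∸ j)                 ≤⟨ ℕ.+-monoʳ-≤ T[ j - n ] (ℕ.n≤1+n _) ⟩
  T[ j - n ] + suc (n + n ∸ j)             ∎
  where
  open ℕ.≤-Reasoning
  swap : ∀ a b c → a + b + c ≡ a + c + b
  swap = ℕ.solve-∀
  split : n + n ≡ j ∸ n + (n + n ∸ j) + n
  split = sym (trans (swap (j ∸ n) (n + n ∸ j) n)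
                     (trans (cong (_+ (n + n ∸ j)) (ℕ.m∸n+n≡m n≤j)) (ℕ.m+[n∸m]≡n j≤2n)))
... | no  n≰j = begin
  n                                        ≡⟨ ℕ.m+n∸n≡m n n ⟨
  n + n ∸ n                                ≤⟨ ℕ.∸-monoʳ-≤ (n + n) (ℕ.<⇒≤ (ℕ.≰⇒> n≰j)) ⟩
  n + n ∸ j                                ≤⟨ ℕ.n≤1+n _ ⟩
  suc (n + n ∸ j)                          ≤⟨ ℕ.m≤n+m _ T[ j - n ] ⟩
  T[ j - n ] + suc (n + n ∸ j)             ∎
  where open ℕ.≤-Reasoning

jacobiTerm-⊛-qPoch : ∀ {n j M} → j ≤ n + n → n + n ≤ M →
                     jacobiTerm n j ⊛ qPoch M ≋ ±𝟙 (j + n) ⊛ X^ T[ j - n ] modX^ n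
jacobiTerm-⊛-qPoch {n} {j} {M} j≤2n 2n≤M =
  modX^-respects-≋ (≋-sym reassociate) (⊛-congˡ (⊛-identityʳ (X^ T[ j - n ])))
    (modX^-⊛ (modX^-refl {f = ±𝟙 (j + n)}) (modX^-mono n≤T+m (modX^-X^-⊛ T[ j - n ] B⊛E≈𝟙)))
  where
  m = j ℕ.⊓ (n + n ∸ j)
  B⊛E≈𝟙 : qBinom (n + n) j ⊛ qPoch M ≋ 𝟙 modX^ suc m
  B⊛E≈𝟙 = qBinom-⊛-qPoch j≤2n 2n≤M (ℕ.m⊓n≤m j (n + n ∸ j)) (ℕ.m⊓n≤n j (n + n ∸ j))
  n≤T+m : n ≤ T[ j - n ] + suc m
  n≤T+m = subst (n ≤_) (sym (ℕ.+-distribˡ-⊓ T[ j - n ] (suc j) (suc (n + n ∸ j))))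
                (ℕ.⊓-glb (T-bound-left j n) (T-bound-right j n j≤2n))
  reassociate : jacobiTerm n j ⊛ qPoch M ≋ ±𝟙 (j + n) ⊛ (X^ T[ j - n ] ⊛ (qBinom (n + n) j ⊛ qPoch M))
  reassociate = solve 4 (λ S E B Q → S :* E :* B :* Q := S :* (E :* (B :* Q)))
                        ≋-refl (±𝟙 (j + n)) (X^ T[ j - n ]) (qBinom (n + n) j) (qPoch M)

jacobiSeries : ℕ → Series
jacobiSeries n = wsum (suc (n + n)) (jacobiWeight n) (λ j → ±𝟙 (j + n) ⊛ X^ T[ j - n ])

jacobi-modX^ : ∀ n → (+ 2) ∙ (qPoch (n + n) ⊛ qPoch (n + n) ⊛ qPoch (n + n)) ≋ jacobiSeries n modX^ n
jacobi-modX^ zero    i ()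
jacobi-modX^ (suc N) =
  modX^-trans (modX^-∙ (+ 2) (modX^-⊛ (modX^-⊛ (modX^-mono (ℕ.n≤1+n n) (stable n≤M)) (stable N≤M)) modX^-refl))
                                   (modX^-respects-≋ (≋-sym expand) ≋-refl (wsum-modX^ (suc M) w terms))
  where
  n = suc N
  M = n + n
  w = jacobiWeight n
  n≤M : n ≤ M
  n≤M = ℕ.m≤m+n n n
  N≤M : N ≤ M
  N≤M = ℕ.≤-trans (ℕ.n≤1+n N) n≤M
  stable : ∀ {a} → a ≤ M → qPoch M ≋ qPoch a modX^ suc a
  stable a≤M = modX^-sym (qPoch-stable a≤M)
  expand : (+ 2) ∙ (qPoch n ⊛ qPoch N ⊛ qPoch M) ≋ wsum (suc M) w (λ j → jacobiTerm n j ⊛ qPoch M)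
  expand = begin
    (+ 2) ∙ (qPoch n ⊛ qPoch N ⊛ qPoch M)
      ≈⟨ ∙-⊛ (+ 2) (qPoch n ⊛ qPoch N) (qPoch M) ⟨
    (+ 2) ∙ (qPoch n ⊛ qPoch N) ⊛ qPoch M
      ≈⟨ ⊛-congʳ (jacobiSum-jacobiWeight N) ⟨
    jacobiSum n w ⊛ qPoch M
      ≈⟨ ⊛-comm (jacobiSum n w) (qPoch M) ⟩
    qPoch M ⊛ jacobiSum n w
      ≈⟨ wsum-⊛ (suc M) w (qPoch M) (jacobiTerm n) ⟨
    wsum (suc M) w (λ j → qPoch M ⊛ jacobiTerm n j)
      ≈⟨ wsum-cong-terms (suc M) w (λ j → ⊛-comm (qPoch M) (jacobiTerm n j)) ⟩
    wsum (suc M) w (λ j → jacobiTerm n j ⊛ qPoch M) ∎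
    where open ≋-Reasoning
  terms : ∀ j → j < suc M → jacobiTerm n j ⊛ qPoch M ≋ ±𝟙 (j + n) ⊛ X^ T[ j - n ] modX^ n
  terms j (s≤s j≤M) = jacobiTerm-⊛-qPoch j≤M ℕ.≤-refl

-- Exponents in prescribed residue classes

ResiduesAtMost : (k : ℕ) .{{_ : ℕ.NonZero k}} → ℕ → Series → Set
ResiduesAtMost k r f = ∀ i → r < i % k → f i ≡ 0ℤ

module _ {k : ℕ} .{{_ : ℕ.NonZero k}} where

  ResiduesAtMost-X^ : ∀ {r} t → t % k ≤ r → ResiduesAtMost k r (X^ t)
  ResiduesAtMost-X^ t t%k≤r i r<i%k = X^-coeff-≢ t (λ { refl → ℕ.<⇒≱ r<i%k t%k≤r })

  ResiduesAtMost-⊕ : ∀ {r f g} → ResiduesAtMost k r f → ResiduesAtMost k r g → ResiduesAtMost k r (f ⊕ g)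
  ResiduesAtMost-⊕ f-bounded g-bounded i r<i%k = cong₂ ℤ._+_ (f-bounded i r<i%k) (g-bounded i r<i%k)

  ResiduesAtMost-⊝ : ∀ {r f} → ResiduesAtMost k r f → ResiduesAtMost k r (⊝ f)
  ResiduesAtMost-⊝ f-bounded i r<i%k = cong ℤ.-_ (f-bounded i r<i%k)

  ResiduesAtMost-∙ : ∀ c {r f} → ResiduesAtMost k r f → ResiduesAtMost k r (c ∙ f)
  ResiduesAtMost-∙ c f-bounded i r<i%k = trans (cong (c ℤ.*_) (f-bounded i r<i%k)) (ℤ.*-zeroʳ c)

  ResiduesAtMost-⊛ : ∀ {a b f g} → ResiduesAtMost k a f → ResiduesAtMost k b g → a + b < k →
                     ResiduesAtMost k (a + b) (f ⊛ g)
  ResiduesAtMost-⊛ {a} {b} {f} {g} f-bounded g-bounded a+b<k n a+b<n%k =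
    coeff-⊛-closed (_≡ 0ℤ) (λ x≡0 y≡0 → cong₂ ℤ._+_ x≡0 y≡0) f g n term
    where
    term : ∀ i j → i + j ≡ n → f i ℤ.* g j ≡ 0ℤ
    term i j i+j≡n with a ℕ.<? i % k | b ℕ.<? j % k
    ... | yes a<i%k | _         = cong (ℤ._* g j) (f-bounded i a<i%k)
    ... | no _      | yes b<j%k = trans (cong (f i ℤ.*_) (g-bounded j b<j%k)) (ℤ.*-zeroʳ (f i))
    ... | no i%k≮a  | no j%k≮b  = ⊥-elim (ℕ.<⇒≱ a+b<n%k (begin
      n % k                    ≡⟨ cong (_% k) i+j≡n ⟨
      (i + j) % k              ≡⟨ ℕ.%-distribˡ-+ i j k ⟩
      (i % k + j % k) % k      ≡⟨ ℕ.m<n⇒m%n≡m (ℕ.≤-<-trans residues a+b<k) ⟩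
      i % k + j % k            ≤⟨ residues ⟩
      a + b                    ∎))
      where
      open ℕ.≤-Reasoning
      residues : i % k + j % k ≤ a + b
      residues = ℕ.+-mono-≤ (ℕ.≮⇒≥ i%k≮a) (ℕ.≮⇒≥ j%k≮b)

LowResidueMod5 : Series → Set
LowResidueMod5 f = Σ[ u ∈ Series ] ResiduesAtMost 5 1 u × f ≋ₘ u

LowResidueMod5-⊕ : ∀ {f g} → LowResidueMod5 f → LowResidueMod5 g → LowResidueMod5 (f ⊕ g)
LowResidueMod5-⊕ (u , u-low , f≡u) (v , v-low , g≡v) = u ⊕ v , ResiduesAtMost-⊕ u-low v-low , ⊕-congₘ f≡u g≡v

LowResidueMod5-∙ : ∀ c {f} → LowResidueMod5 f → LowResidueMod5 (c ∙ f)
LowResidueMod5-∙ c (u , u-low , f≡u) = c ∙ u , ResiduesAtMost-∙ c u-low , ∙-congₘ c f≡u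

LowResidueMod5-⊝ : ∀ {f} → LowResidueMod5 f → LowResidueMod5 (⊝ f)
LowResidueMod5-⊝ (u , u-low , f≡u) = ⊝ u , ResiduesAtMost-⊝ u-low , ⊝-congₘ f≡u

LowResidueMod5-≋ : ∀ {f g} → f ≋ g → LowResidueMod5 f → LowResidueMod5 g
LowResidueMod5-≋ f≋g (u , u-low , f≡u) = u , u-low , ≋ₘ-trans (≋⇒≋ₘ (≋-sym f≋g)) f≡u

LowResidueMod5-wsum : ∀ L w r → (∀ j → LowResidueMod5 (w j ∙ r j)) → LowResidueMod5 (wsum L w r)
LowResidueMod5-wsum zero    w r low = 𝟘 , (λ _ _ → refl) , ≋⇒≋ₘ ≋-refl
LowResidueMod5-wsum (suc L) w r low =
  LowResidueMod5-⊕ (low 0) (LowResidueMod5-wsum L (w ∘ suc) (r ∘ suc) (low ∘ suc))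

±𝟙-⊛ : ∀ k g → (±𝟙 k ⊛ g ≋ g) ⊎ (±𝟙 k ⊛ g ≋ ⊝ g)
±𝟙-⊛ zero    g = inj₁ (⊛-identityˡ g)
±𝟙-⊛ (suc k) g with ±𝟙-⊛ k g
... | inj₁ ±g≋g  = inj₂ (≋-trans (⊝-⊛ (±𝟙 k) g) (⊝-cong ±g≋g))
... | inj₂ ±g≋-g = inj₁ (≋-trans (⊝-⊛ (±𝟙 k) g) (≋-trans (⊝-cong ±g≋-g) (mk≋ (ℤ.neg-involutive ∘ g))))

LowResidueMod5-±𝟙-⊛ : ∀ k {g} → LowResidueMod5 g → LowResidueMod5 (±𝟙 k ⊛ g)
LowResidueMod5-±𝟙-⊛ k {g} g-low with ±𝟙-⊛ k g
... | inj₁ ±g≋g  = LowResidueMod5-≋ (≋-sym ±g≋g) g-low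
... | inj₂ ±g≋-g = LowResidueMod5-≋ (≋-sym ±g≋-g) (LowResidueMod5-⊝ g-low)

triangular-mod5 : ∀ m → 5 ℕ.∣ 2 * m + 1 ⊎ triangular m % 5 ≤ 1
triangular-mod5 0 = inj₂ z≤n
triangular-mod5 1 = inj₂ (s≤s z≤n)
triangular-mod5 2 = inj₁ (ℕ.divides 1 refl)
triangular-mod5 3 = inj₂ (s≤s z≤n)
triangular-mod5 4 = inj₂ z≤n
triangular-mod5 (suc (suc (suc (suc (suc m))))) with triangular-mod5 m
... | inj₁ 5∣2m+1 = inj₁ (subst (5 ℕ.∣_) (odd-shift m) (ℕ.∣m∣n⇒∣m+n 5∣2m+1 (ℕ.divides 2 refl)))
  where
  odd-shift : ∀ m → 2 * m + 1 + 10 ≡ 2 * (5 + m) + 1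
  odd-shift = ℕ.solve-∀
... | inj₂ low = inj₂ (subst (_≤ 1) (sym residue) low)
  where
  period : ∀ m t → 5 + m + (4 + m + (3 + m + (2 + m + (1 + m + t)))) ≡ t + (m + 3) * 5
  period = ℕ.solve-∀
  residue : triangular (5 + m) % 5 ≡ triangular m % 5
  residue = trans (cong (_% 5) (period m (triangular m))) (ℕ.[m+kn]%n≡m%n (triangular m) (m + 3) 5)

pos-odd : ∀ m → + (2 * m + 1) ≡ + 2 ℤ.* + m ℤ.+ 1ℤ
pos-odd m = trans (ℤ.pos-+ (2 * m) 1) (cong (ℤ._+ 1ℤ) (ℤ.pos-* 2 m))

T-mod5 : ∀ k → + 5 ℤ.∣ + 2 ℤ.* k ℤ.+ 1ℤ ⊎ T k % 5 ≤ 1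
T-mod5 (+ m) with triangular-mod5 m
... | inj₁ 5∣2m+1 = inj₁ (subst (+ 5 ℤ.∣_) (pos-odd m) (ℤ.∣ᵤ⇒∣ 5∣2m+1))
... | inj₂ low     = inj₂ low
T-mod5 -[1+ m ] with triangular-mod5 m
... | inj₁ 5∣2m+1 = inj₁ (subst (+ 5 ℤ.∣_) (reflect m) (ℤ.∣m⇒∣-m (ℤ.∣ᵤ⇒∣ 5∣2m+1)))
  where
  negate : ∀ x → ℤ.- (+ 2 ℤ.* x ℤ.+ 1ℤ) ≡ + 2 ℤ.* (ℤ.- (1ℤ ℤ.+ x)) ℤ.+ 1ℤ
  negate = solve-∀
  reflect : ∀ m → ℤ.- + (2 * m + 1) ≡ + 2 ℤ.* -[1+ m ] ℤ.+ 1ℤ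
  reflect m = trans (cong ℤ.-_ (pos-odd m)) (negate (+ m))
... | inj₂ low     = inj₂ low

jacobiSeries-low : ∀ n → LowResidueMod5 (jacobiSeries n)
jacobiSeries-low n = LowResidueMod5-wsum (suc (n + n)) (jacobiWeight n) (λ j → ±𝟙 (j + n) ⊛ X^ T[ j - n ]) term
  where
  term : ∀ j → LowResidueMod5 (jacobiWeight n j ∙ (±𝟙 (j + n) ⊛ X^ T[ j - n ]))
  term j with T-mod5 (+ j ℤ.- + n)
  ... | inj₁ 5∣w = 𝟘 , (λ _ _ → refl) , ∣⇒∙≋ₘ𝟘 _ 5∣w
  ... | inj₂ low = LowResidueMod5-∙ (jacobiWeight n j)
                     (LowResidueMod5-±𝟙-⊛ (j + n) (X^ T[ j - n ] , X^-low , ≋⇒≋ₘ ≋-refl))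
    where
    X^-low : ResiduesAtMost 5 1 (X^ T[ j - n ])
    X^-low = ResiduesAtMost-X^ T[ j - n ] low

cube-coeff-≡ₘ0 : ∀ {f} → LowResidueMod5 f → ∀ n → n % 5 ≡ 4 → (f ⊛ f ⊛ f) n ≡ₘ 0ℤ
cube-coeff-≡ₘ0 (u , u-low , f≡u) n n%5≡4 =
  ≡ₘ-trans (⊛-congₘ (⊛-congₘ f≡u f≡u) f≡u n) (≡ₘ-reflexive (u³-low n (subst (3 <_) (sym n%5≡4) ℕ.≤-refl)))
  where
  u³-low : ResiduesAtMost 5 3 (u ⊛ u ⊛ u)
  u³-low = ResiduesAtMost-⊛ (ResiduesAtMost-⊛ u-low u-low (s≤s (s≤s (s≤s z≤n)))) u-low (s≤s (s≤s (s≤s (s≤s z≤n))))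

-- Ramanujan's congruence p(5m + 4) ≡ 0 (mod 5)

cube : Series → Series
cube f = f ⊛ f ⊛ f

fifth : Series → Series
fifth f = f ⊛ f ⊛ f ⊛ f ⊛ f

X^-fifth : ∀ a → fifth (X^ a) ≋ X^ (5 * a)
X^-fifth a = begin
  X^ a ⊛ X^ a ⊛ X^ a ⊛ X^ a ⊛ X^ a       ≈⟨ ⊛-congʳ (⊛-congʳ (⊛-congʳ (X^-+ a a))) ⟩
  X^ (a + a) ⊛ X^ a ⊛ X^ a ⊛ X^ a         ≈⟨ ⊛-congʳ (⊛-congʳ (X^-+ (a + a) a)) ⟩
  X^ (a + a + a) ⊛ X^ a ⊛ X^ a            ≈⟨ ⊛-congʳ (X^-+ (a + a + a) a) ⟩
  X^ (a + a + a + a) ⊛ X^ a               ≈⟨ X^-+ (a + a + a + a) a ⟩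
  X^ (a + a + a + a + a)                  ≈⟨ ≋-reflexive (cong X^_ (five-times a)) ⟩
  X^ (5 * a)                              ∎
  where
  open ≋-Reasoning
  five-times : ∀ a → a + a + a + a + a ≡ 5 * a
  five-times = ℕ.solve-∀

𝟙-X^-fifth : ∀ a → fifth (𝟙-X^ a) ≋ₘ 𝟙-X^ (5 * a)
𝟙-X^-fifth a = ≋ₘ-intro R (begin
  fifth (𝟙 ⊕ ⊝ Y)
    ≈⟨ solve 1 (λ Y → (con 1ℤ :- Y) :* (con 1ℤ :- Y) :* (con 1ℤ :- Y) :* (con 1ℤ :- Y) :* (con 1ℤ :- Y)
                   := con 1ℤ :- Y :* Y :* Y :* Y :* Y
                      :+ con (+ 5) :* (:- Y :+ con (+ 2) :* Y :* Y :- con (+ 2) :* Y :* Y :* Y :+ Y :* Y :* Y :* Y))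
             ≋-refl Y ⟩
  𝟙 ⊕ ⊝ fifth Y ⊕ const (+ 5) ⊛ R
    ≈⟨ ⊕-cong (⊕-cong (≋-refl {𝟙}) (⊝-cong (X^-fifth a))) (const-⊛ (+ 5) R) ⟩
  𝟙-X^ (5 * a) ⊕ (+ 5) ∙ R
    ∎)
  where
  open ≋-Reasoning
  Y = X^ a
  R = ⊝ Y ⊕ const (+ 2) ⊛ Y ⊛ Y ⊕ ⊝ (const (+ 2) ⊛ Y ⊛ Y ⊛ Y) ⊕ Y ⊛ Y ⊛ Y ⊛ Y

qPoch-q⁵ : ℕ → Series
qPoch-q⁵ zero    = 𝟙
qPoch-q⁵ (suc k) = qPoch-q⁵ k ⊛ 𝟙-X^ (5 * suc k)

qPoch-fifth : ∀ M → fifth (qPoch M) ≋ₘ qPoch-q⁵ M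
qPoch-fifth zero    = ≋⇒≋ₘ (solve 0 (con 1ℤ :* con 1ℤ :* con 1ℤ :* con 1ℤ :* con 1ℤ := con 1ℤ) ≋-refl)
qPoch-fifth (suc M) = ≋ₘ-trans (≋⇒≋ₘ split) (⊛-congₘ (qPoch-fifth M) (𝟙-X^-fifth (suc M)))
  where
  split : fifth (qPoch M ⊛ 𝟙-X^ suc M) ≋ fifth (qPoch M) ⊛ fifth (𝟙-X^ suc M)
  split = solve 2 (λ E L → (E :* L) :* (E :* L) :* (E :* L) :* (E :* L) :* (E :* L)
                        := (E :* E :* E :* E :* E) :* (L :* L :* L :* L :* L))
                  ≋-refl (qPoch M) (𝟙-X^ suc M)

qPoch-q⁵-multiplesOf5 : ∀ M → ResiduesAtMost 5 0 (qPoch-q⁵ M)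
qPoch-q⁵-multiplesOf5 zero    = ResiduesAtMost-X^ 0 z≤n
qPoch-q⁵-multiplesOf5 (suc M) =
  ResiduesAtMost-⊛ (qPoch-q⁵-multiplesOf5 M) 𝟙-X^5a-multiplesOf5 (s≤s z≤n)
  where
  5a%5≤0 : (5 * suc M) % 5 ≤ 0
  5a%5≤0 = ℕ.≤-reflexive (trans (cong (_% 5) (ℕ.*-comm 5 (suc M))) (ℕ.m*n%n≡0 (suc M) 5))
  𝟙-X^5a-multiplesOf5 : ResiduesAtMost 5 0 (𝟙-X^ (5 * suc M))
  𝟙-X^5a-multiplesOf5 =
    ResiduesAtMost-⊕ (ResiduesAtMost-X^ 0 z≤n) (ResiduesAtMost-⊝ (ResiduesAtMost-X^ (5 * suc M) 5a%5≤0))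

qPoch-q⁵-constant : ∀ M → qPoch-q⁵ M 0 ≡ 1ℤ
qPoch-q⁵-constant zero    = refl
qPoch-q⁵-constant (suc M) = trans (ℤ.*-identityʳ (qPoch-q⁵ M 0)) (qPoch-q⁵-constant M)

P≤⊛qPoch-q⁵²≋ₘqPoch⁹ : ∀ M → P≤ M ⊛ (qPoch-q⁵ M ⊛ qPoch-q⁵ M) ≋ₘ cube (cube (qPoch M))
P≤⊛qPoch-q⁵²≋ₘqPoch⁹ M = ≋ₘ-trans (⊛-congₘ (≋⇒≋ₘ (≋-refl {P})) (⊛-congₘ F≡E⁵ F≡E⁵)) (≋⇒≋ₘ (begin
  P ⊛ (fifth E ⊛ fifth E)
    ≈⟨ solve 2 (λ P E → P :* ((E :* E :* E :* E :* E) :* (E :* E :* E :* E :* E))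
                     := (E :* E :* E) :* (E :* E :* E) :* (E :* E :* E) :* (E :* P))
             ≋-refl P E ⟩
  cube (cube E) ⊛ (E ⊛ P)          ≈⟨ ⊛-congˡ (qPoch-⊛-P≤ M) ⟩
  cube (cube E) ⊛ 𝟙                ≈⟨ ⊛-identityʳ (cube (cube E)) ⟩
  cube (cube E)                    ∎))
  where
  open ≋-Reasoning
  P = P≤ M
  E = qPoch M
  F≡E⁵ : qPoch-q⁵ M ≋ₘ fifth E
  F≡E⁵ = ≋ₘ-sym (qPoch-fifth M)

5m+4-split : ∀ {m l j} → j + l * 5 ≡ 5 * m + 4 → 0 < l → m ∸ l < m × j ≡ 5 * (m ∸ l) + 4
5m+4-split {m} {l} {j} j+5l≡5m+4 0<l =
  ℕ.∸-monoʳ-< 0<l l≤m , ℕ.+-cancelʳ-≡ (l * 5) j (5 * (m ∸ l) + 4) (trans j+5l≡5m+4 (sym recombine))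
  where
  l≤m : l ≤ m
  l≤m = ℕ.≤-pred (ℕ.*-cancelʳ-< 5 l (suc m) (ℕ.≤-<-trans (ℕ.≤-trans (ℕ.m≤n+m (l * 5) j) (ℕ.≤-reflexive j+5l≡5m+4))
                                                          (ℕ.≤-reflexive (next-multiple m))))
    where
    next-multiple : ∀ m → suc (5 * m + 4) ≡ suc m * 5
    next-multiple = ℕ.solve-∀
  recombine : 5 * (m ∸ l) + 4 + l * 5 ≡ 5 * m + 4
  recombine = trans (distribute (m ∸ l) l) (cong (λ x → 5 * x + 4) (ℕ.m∸n+n≡m l≤m))
    where
    distribute : ∀ a b → 5 * a + 4 + b * 5 ≡ 5 * (a + b) + 4
    distribute = ℕ.solve-∀

coeff-5m+4-≡ₘ0 : ∀ {f g} → g 0 ≡ 1ℤ → ResiduesAtMost 5 0 g → ∀ m₀ →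
                 (∀ m → m ≤ m₀ → (f ⊛ g) (5 * m + 4) ≡ₘ 0ℤ) → ∀ m → m ≤ m₀ → f (5 * m + 4) ≡ₘ 0ℤ
coeff-5m+4-≡ₘ0 {f} {g} g0≡1 g-multiplesOf5 m₀ product≡0 = <-rec (λ m → m ≤ m₀ → f (5 * m + 4) ≡ₘ 0ℤ) step
  where
  step : ∀ m → (∀ {m′} → m′ < m → m′ ≤ m₀ → f (5 * m′ + 4) ≡ₘ 0ℤ) → m ≤ m₀ → f (5 * m + 4) ≡ₘ 0ℤ
  step m IH m≤m₀ = subst (λ i → f i ≡ₘ 0ℤ) (sym 5m+4≡1+k)
                         (≡ₘ-trans (≡ₘ-reflexive (sym g₀f≡f)) (+-cancelʳ-≡ₘ0 leading rest))
    where
    k = 5 * m + 3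
    5m+4≡1+k : 5 * m + 4 ≡ suc k
    5m+4≡1+k = ℕ.+-suc (5 * m) 3
    g₀f≡f : g 0 ℤ.* f (suc k) ≡ f (suc k)
    g₀f≡f = trans (cong (ℤ._* f (suc k)) g0≡1) (ℤ.*-identityˡ (f (suc k)))
    leading : (g ⊛ f) (suc k) ≡ₘ 0ℤ
    leading = subst (λ i → (g ⊛ f) i ≡ₘ 0ℤ) 5m+4≡1+k
                    (≡ₘ-trans (≡ₘ-reflexive (coeff (⊛-comm g f) (5 * m + 4))) (product≡0 m m≤m₀))
    term : ∀ i j → i + j ≡ k → g (suc i) ℤ.* f j ≡ₘ 0ℤ
    term i j i+j≡k with 5 ℕ.∣? suc i
    ... | no 5∤1+i =
      ≡ₘ-reflexive (cong (ℤ._* f j) (g-multiplesOf5 (suc i) (ℕ.n≢0⇒n>0 (5∤1+i ∘ ℕ.m%n≡0⇒n∣m (suc i) 5))))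
    ... | yes (ℕ.divides l 1+i≡l*5) =
      ≡ₘ-trans (*-cong (≡ₘ-refl {g (suc i)}) fⱼ≡0) (≡ₘ-reflexive (ℤ.*-zeroʳ (g (suc i))))
      where
      j+5l≡5m+4 : j + l * 5 ≡ 5 * m + 4
      j+5l≡5m+4 = trans (cong (_+_ j) (sym 1+i≡l*5))
                        (trans (ℕ.+-suc j i) (trans (cong suc (trans (ℕ.+-comm j i) i+j≡k)) (sym 5m+4≡1+k)))
      0<l : 0 < l
      0<l = ℕ.n≢0⇒n>0 (λ l≡0 → ℕ.1+n≢0 (trans 1+i≡l*5 (cong (_* 5) l≡0)))
      m∸l<m = proj₁ (5m+4-split j+5l≡5m+4 0<l)
      j≡5[m∸l]+4 = proj₂ (5m+4-split j+5l≡5m+4 0<l)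
      fⱼ≡0 : f j ≡ₘ 0ℤ
      fⱼ≡0 = subst (λ x → f x ≡ₘ 0ℤ) (sym j≡5[m∸l]+4) (IH m∸l<m (ℕ.≤-trans (ℕ.m∸n≤m m l) m≤m₀))
    rest : (tail g ⊛ f) k ≡ₘ 0ℤ
    rest = coeff-⊛-closed (_≡ₘ 0ℤ) +-cong (tail g) f k term

cube-2∙ : ∀ f → cube ((+ 2) ∙ f) ≋ (+ 8) ∙ cube f
cube-2∙ f = begin
  cube ((+ 2) ∙ f)
    ≈⟨ ⊛-cong (⊛-cong (∙-as-const (+ 2) f) (∙-as-const (+ 2) f)) (∙-as-const (+ 2) f) ⟩
  cube (const (+ 2) ⊛ f)
    ≈⟨ solve 1 (λ f → con (+ 2) :* f :* (con (+ 2) :* f) :* (con (+ 2) :* f)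
                   := con (+ 8) :* (f :* f :* f))
             ≋-refl f ⟩
  const (+ 8) ⊛ cube f
    ≈⟨ const-⊛ (+ 8) (cube f) ⟩
  (+ 8) ∙ cube f ∎
  where open ≋-Reasoning

8*x≡ₘ0⇒x≡ₘ0 : ∀ {x} → + 8 ℤ.* x ≡ₘ 0ℤ → x ≡ₘ 0ℤ
8*x≡ₘ0⇒x≡ₘ0 {x} 8x≡0 =
  ≡ₘ-trans (≡ₘ-reflexive (inverse x))
           (+-cong (*-cong (≡ₘ-refl {+ 2}) 8x≡0) (∣⇒≡ₘ0 (ℤ.∣n⇒∣m*n (ℤ.- + 3 ℤ.* x) ℤ.∣-refl)))
  where
  inverse : ∀ x → x ≡ + 2 ℤ.* (+ 8 ℤ.* x) ℤ.+ (ℤ.- + 3 ℤ.* x) ℤ.* + 5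
  inverse = solve-∀

ramanujan-congruence : ∀ m → + p (5 * m + 4) ≡ₘ 0ℤ
ramanujan-congruence m = subst (_≡ₘ 0ℤ) (P≤-coeff N≤M)
                               (coeff-5m+4-≡ₘ0 F²-constant F²-multiplesOf5 m P≤⊛F²-coeff m ℕ.≤-refl)
  where
  N = 5 * m + 4
  n = suc N
  M = n + n
  E = qPoch M
  F = qPoch-q⁵ M
  N≤M : N ≤ M
  N≤M = ℕ.≤-trans (ℕ.n≤1+n N) (ℕ.m≤m+n n n)
  F²-constant : (F ⊛ F) 0 ≡ 1ℤ
  F²-constant = cong₂ ℤ._*_ (qPoch-q⁵-constant M) (qPoch-q⁵-constant M)
  F²-multiplesOf5 : ResiduesAtMost 5 0 (F ⊛ F)
  F²-multiplesOf5 = ResiduesAtMost-⊛ (qPoch-q⁵-multiplesOf5 M) (qPoch-q⁵-multiplesOf5 M) (s≤s z≤n)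
  E⁹-coeff : ∀ {i} → i < n → i % 5 ≡ 4 → cube (cube E) i ≡ₘ 0ℤ
  E⁹-coeff {i} i<n i%5≡4 = 8*x≡ₘ0⇒x≡ₘ0 (≡ₘ-trans (≡ₘ-reflexive 8E⁹≡J³) (cube-coeff-≡ₘ0 (jacobiSeries-low n) i i%5≡4))
    where
    J = jacobi-modX^ n
    8E⁹≡J³ : + 8 ℤ.* cube (cube E) i ≡ cube (jacobiSeries n) i
    8E⁹≡J³ = trans (sym (coeff (cube-2∙ (cube E)) i)) (modX^-⊛ (modX^-⊛ J J) J i i<n)
  P≤⊛F²-coeff : ∀ m′ → m′ ≤ m → (P≤ M ⊛ (F ⊛ F)) (5 * m′ + 4) ≡ₘ 0ℤ
  P≤⊛F²-coeff m′ m′≤m = ≡ₘ-trans (P≤⊛qPoch-q⁵²≋ₘqPoch⁹ M (5 * m′ + 4)) (E⁹-coeff below residue)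
    where
    below : 5 * m′ + 4 < n
    below = s≤s (ℕ.+-monoˡ-≤ 4 (ℕ.*-monoʳ-≤ 5 m′≤m))
    residue : (5 * m′ + 4) % 5 ≡ 4
    residue = trans (cong (_% 5) (trans (ℕ.+-comm (5 * m′) 4) (cong (_+_ 4) (ℕ.*-comm 5 m′))))
                    (ℕ.[m+kn]%n≡m%n 4 m′ 5)

proposition6p10 : (n : ℕ) → + 5 ∣ Mχ₅₃ (5 * n + 4)
proposition6p10 n = ℤ.∣⇒∣ᵤ (≡ₘ0⇒∣ (begin
  Mχ₅₃ N          ≈⟨ Mχ₅₃≡ₘn*p N ⟩
  + N ℤ.* + p N   ≈⟨ *-cong (≡ₘ-refl {+ N}) (ramanujan-congruence n) ⟩
  + N ℤ.* 0ℤ      ≡⟨ ℤ.*-zeroʳ (+ N) ⟩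
  0ℤ              ∎))
  where
  open ≡ₘ-Reasoning
  N = 5 * n + 4
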